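{- There exists an undirected graph class in $\mathsf{G}\,\mathrm{AC}^0$ that is not a subset of any small and hereditary graph class; i.e. $\mathsf{G}\,\mathrm{AC}^0\not\subseteq[\mathrm{Small}\cap\mathrm{Hereditary}]_{\subseteq}$.
   Context: A graph class is a set of finite graphs closed under isomorphism. $\log n=\lceil\log_2 n\rceil$. A labeling scheme is a pair $S=(F,c)$ with $F\subseteq\{0,1\}^*\times\{0,1\}^*$, $c\in\mathbb{N}$; a graph $G$ with $n$ vertices is in $\mathrm{gr}(S)$ if there is $\ell\colon V(G)\to\{0,1\}^{c\log n}$ with $(u,v)\in E(G)\iff(\ell(u),\ell(v))\in F$ for all $u,v\in V(G)$. A language $L$ induces $F_L=\{(x,y):|x|=|y|,\ xy\in L\}$; $\mathsf{G}\,\mathsf{A}$ is the set of graph classes $\mathcal{C}$ with $\mathcal{C}\subseteq\mathrm{gr}(F_L,c)$ for some $L\in\mathsf{A}$, $c\in\mathbb{N}$. $\mathrm{AC}^0$ is the class of languages decided by logspace-uniform, constant-depth, polynomial-size circuit families with AND, OR, NOT gates. A graph class $\mathcal{C}$ is small if the number of graphs (up to isomorphism) with $n$ vertices in $\mathcal{C}$ is at most $n^{O(n)}$, and hereditary if it is closed under taking induced subgraphs. $[\mathrm{Small}\cap\mathrm{Hereditary}]_{\subseteq}$ is the set of graph classes contained in some small hereditary graph class. -}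

module Defs where

open import Data.Nat using (ℕ; zero; suc; _+_; _*_; _^_; _≤_; _<_; _⊔_; _⊓_; _≡ᵇ_; _∸_)
open import Data.Nat.Logarithm using (⌈log₂_⌉)
open import Data.Nat.Binary.Base using (ℕᵇ; 2[1+_]; 1+[2_]) renaming (zero to zeroᵇ; fromℕ to toBin)
open import Data.Bool using (Bool; true; false; not; _∧_; _∨_; if_then_else_)
open import Data.Fin using (Fin)
open import Data.List using (List; []; _∷_; _++_; length; replicate; concat; map; foldr)
open import Data.Vec using (Vec; toList)
open import Data.Maybe using (Maybe; just; nothing)
open import Data.Product using (Σ; ∃; ∃-syntax; _×_; _,_)
open import Relation.Binary.PropositionalEquality using (_≡_)
open import Relation.Nullary using (¬_)
open import Function.Bundles using (_↔_; _⇔_; Inverse)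
open import Function.Definitions using (Injective)

record Graph : Set where
  field
    n     : ℕ
    adj   : Fin n → Fin n → Bool
    sym   : ∀ u v → adj u v ≡ adj v u
    irrefl : ∀ u → adj u u ≡ false
open Graph public

Iso : Graph → Graph → Set
Iso G H = Σ (Fin (n G) ↔ Fin (n H)) λ π →
  ∀ u v → adj H (Inverse.to π u) (Inverse.to π v) ≡ adj G u v

record GraphClass : Set₁ where
  field
    member : Graph → Set
    iso-closed : ∀ G H → Iso G H → member G → member H
open GraphClass public

_⊆ᶜ_ : GraphClass → GraphClass → Set
C ⊆ᶜ D = ∀ G → member C G → member D G

induced : (G : Graph) → (m : ℕ) → (Fin m → Fin (n G)) → Graph
induced G m f = record
  { n = m
  ; adj = λ u v → adj G (f u) (f v)
  ; sym = λ u v → sym G (f u) (f v)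
  ; irrefl = λ u → irrefl G (f u) }

Hereditary : GraphClass → Set
Hereditary D = ∀ G (m : ℕ) (f : Fin m → Fin (n G)) → Injective _≡_ _≡_ f →
  member D G → member D (induced G m f)

AtMostClasses : GraphClass → ℕ → ℕ → Set
AtMostClasses D k m = Σ (List Graph) λ reps → length reps ≤ k ×
  (∀ G → n G ≡ m → member D G → AnyIso G reps)
  where
  AnyIso : Graph → List Graph → Set
  AnyIso G [] = Data.Empty.⊥
    where import Data.Empty
  AnyIso G (H ∷ Hs) = Iso G H Data.Sum.⊎ AnyIso G Hs
    where import Data.Sum

Small : GraphClass → Set
Small D = ∃[ c ] ∃[ N ] (∀ m → N ≤ m → AtMostClasses D (m ^ (c * m)) m)

InSmallHereditaryClosure : GraphClass → Set₁
InSmallHereditaryClosure C = Σ GraphClass λ D → Small D × Hereditary D × C ⊆ᶜ D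

Language : Set₁
Language = List Bool → Set

InGr : (List Bool → List Bool → Set) → ℕ → Graph → Set
InGr F c G = Σ (Fin (n G) → Vec Bool (c * ⌈log₂ (n G) ⌉)) λ ℓ →
  ∀ u v → (adj G u v ≡ true) ⇔ F (toList (ℓ u)) (toList (ℓ v))

F[_] : Language → List Bool → List Bool → Set
F[ L ] x y = (length x ≡ length y) × L (x ++ y)

-- Boolean circuits (unbounded fan-in AND/OR, NOT), as a list of gates in
-- topological order; gates refer to earlier gates by their index.

data Gate : Set where
  input : ℕ → Gate
  notG  : ℕ → Gate
  andG  : List ℕ → Gate
  orG   : List ℕ → Gate

Circuit : Set
Circuit = List Gate

All≤ : List ℕ → ℕ → Set
All≤ [] k = Data.Unit.⊤
  where import Data.Unit
All≤ (j ∷ js) k = (j < k) × All≤ js k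

-- well-formed circuit with n inputs (i-th gate only refers to gates < i);
-- argument k = number of gates already placed
WFGates : ℕ → ℕ → Circuit → Set
WFGates n k [] = Data.Unit.⊤
  where import Data.Unit
WFGates n k (input i ∷ gs) = (i < n) × WFGates n (suc k) gs
WFGates n k (notG j ∷ gs)  = (j < k) × WFGates n (suc k) gs
WFGates n k (andG js ∷ gs) = All≤ js k × WFGates n (suc k) gs
WFGates n k (orG js ∷ gs)  = All≤ js k × WFGates n (suc k) gs

-- well-formed and nonempty (output gate = last gate)
WF : ℕ → Circuit → Set
WF n C = (1 ≤ length C) × WFGates n 0 C

nth : {A : Set} → A → List A → ℕ → A
nth d [] _ = d
nth d (x ∷ xs) zero = x
nth d (x ∷ xs) (suc i) = nth d xs i

lastOr : {A : Set} → A → List A → A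
lastOr d [] = d
lastOr d (x ∷ xs) = lastOr x xs

gateVal : List Bool → List Bool → Gate → Bool
gateVal x vals (input i) = nth false x i
gateVal x vals (notG j)  = not (nth false vals j)
gateVal x vals (andG js) = foldr (λ j b → nth false vals j ∧ b) true js
gateVal x vals (orG js)  = foldr (λ j b → nth false vals j ∨ b) false js

gateVals : List Bool → List Bool → Circuit → List Bool
gateVals x acc [] = acc
gateVals x acc (g ∷ gs) = gateVals x (acc ++ (gateVal x acc g ∷ [])) gs

eval : Circuit → List Bool → Bool
eval C x = lastOr false (gateVals x [] C)

gateDepth : List ℕ → Gate → ℕ
gateDepth ds (input i) = 0
gateDepth ds (notG j)  = suc (nth 0 ds j)
gateDepth ds (andG js) = suc (foldr (λ j m → nth 0 ds j ⊔ m) 0 js)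
gateDepth ds (orG js)  = suc (foldr (λ j m → nth 0 ds j ⊔ m) 0 js)

gateDepths : List ℕ → Circuit → List ℕ
gateDepths acc [] = acc
gateDepths acc (g ∷ gs) = gateDepths (acc ++ (gateDepth acc g ∷ [])) gs

depth : Circuit → ℕ
depth C = foldr _⊔_ 0 (gateDepths [] C)

size : Circuit → ℕ
size = length

-- bijective base-2 digits of a natural number, digit 1 ↦ 10, digit 2 ↦ 11,
-- terminated by 0
encBin : ℕᵇ → List Bool
encBin zeroᵇ = false ∷ []
encBin 2[1+ x ] = true ∷ true ∷ encBin x
encBin 1+[2 x ] = true ∷ false ∷ encBin x

encℕ : ℕ → List Bool
encℕ k = encBin (toBin k)

encList : List ℕ → List Bool
encList [] = false ∷ []
encList (j ∷ js) = true ∷ (encℕ j ++ encList js)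

encGate : Gate → List Bool
encGate (input i) = false ∷ false ∷ encℕ i
encGate (notG j)  = false ∷ true ∷ encℕ j
encGate (andG js) = true ∷ false ∷ encList js
encGate (orG js)  = true ∷ true ∷ encList js

encCircuit : Circuit → List Bool
encCircuit [] = false ∷ []
encCircuit (g ∷ gs) = true ∷ (encGate g ++ encCircuit gs)

-- Deterministic Turing machine transducers with a read-only input tape
-- (with endmarker), one work tape, and a write-only output tape.

data Move : Set where
  left stay right : Move

record TM : Set where
  field
    Q     : ℕ
    Γ     : ℕ                  -- work alphabet is Fin (suc Γ), zero = blank
    start : Fin Q
    -- transition: current state, input symbol (nothing = endmarker),
    -- work symbol ↦ halt (nothing) or
    -- (new state, written work symbol, input move, work move, output bit?)
    δ     : Fin Q → Maybe Bool → Fin (suc Γ) →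
            Maybe (Fin Q × Fin (suc Γ) × Move × Move × Maybe Bool)

record Config (M : TM) : Set where
  field
    state : Fin (TM.Q M)
    ipos  : ℕ
    work  : ℕ → Fin (suc (TM.Γ M))
    wpos  : ℕ
    out   : List Bool

move : Move → ℕ → ℕ
move left p = p ∸ 1
move stay p = p
move right p = suc p

readInput : List Bool → ℕ → Maybe Bool
readInput [] _ = nothing
readInput (b ∷ bs) zero = just b
readInput (b ∷ bs) (suc i) = readInput bs i

initConfig : (M : TM) → Config M
initConfig M = record { state = TM.start M ; ipos = 0 ; work = λ _ → Fin.zero
                      ; wpos = 0 ; out = [] }
  where import Data.Fin as Fin

-- one step; halted configurations stay fixed.
-- The input head ranges over positions 0 .. |x| (position |x| is the endmarker).
step : (M : TM) → List Bool → Config M → Config M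
step M x c with TM.δ M (Config.state c) (readInput x (Config.ipos c))
                       (Config.work c (Config.wpos c))
... | nothing = c
... | just (q , a , mi , mw , o) = record
  { state = q
  ; ipos  = move mi (Config.ipos c) ⊓ length x
  ; work  = λ p → if p ≡ᵇ Config.wpos c then a else Config.work c p
  ; wpos  = move mw (Config.wpos c)
  ; out   = outNew o }
  where
  outNew : Maybe Bool → List Bool
  outNew nothing  = Config.out c
  outNew (just b) = Config.out c ++ (b ∷ [])

halted : (M : TM) → List Bool → Config M → Set
halted M x c = TM.δ M (Config.state c) (readInput x (Config.ipos c))
                      (Config.work c (Config.wpos c)) ≡ nothing

run : (M : TM) → List Bool → ℕ → Config M
run M x zero = initConfig M
run M x (suc t) = step M x (run M x t)

ComputesInSpace : (M : TM) → List Bool → List Bool → ℕ → Set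
ComputesInSpace M x y s =
  (∃[ t ] (halted M x (run M x t) × Config.out (run M x t) ≡ y)) ×
  (∀ t → Config.wpos (run M x t) ≤ s)

LogspaceUniform : (ℕ → Circuit) → Set
LogspaceUniform C = Σ TM λ M → ∃[ c ] (∀ m →
  ComputesInSpace M (replicate m true) (encCircuit (C m)) (c * ⌈log₂ m ⌉ + c))

AC⁰ : Language → Set
AC⁰ L = Σ (ℕ → Circuit) λ C → LogspaceUniform C ×
  (∀ m → WF m (C m)) ×
  (∃[ d ] ∀ m → depth (C m) ≤ d) ×
  (∃[ k ] ∀ m → size (C m) ≤ suc m ^ k) ×
  (∀ x → L x ⇔ (eval (C (length x)) x ≡ true))

GAC⁰ : GraphClass → Set₁
GAC⁰ 𝒞 = Σ Language λ L → AC⁰ L × ∃[ c ] (∀ G → member 𝒞 G → InGr F[ L ] c G)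

-- The language ParentPair of words w having a position q with w_q = w_(parent q) = 1, where
-- parent is the heap order, is decided by a depth-2 circuit whose gate list a logspace machine
-- can print: the bijective binary digits of 2q+1 and of parent q are read off those of q.
-- Writing 1s at position 2·id u and at positions g + id v for the neighbours v of u gives every
-- graph, padded with isolated vertices to 2^h vertices so that labels of length h are allowed,
-- a labelling by F_ParentPair.  A hereditary class containing this class therefore contains
-- every graph, in particular the 2^(t²) bipartite graphs on 2t labelled vertices; these fall
-- into at least 2^(t²)/(2t)^(2t) isomorphism classes, more than a small class permits.

module Submission where

open import Defs hiding (sym)
open import Data.Nat using (ℕ; zero; suc; _+_; _*_; _^_; _≤_; _<_; _⊔_; _⊓_; _≡ᵇ_; _∸_; z≤n; s≤s; ⌊_/2⌋; _≤?_; _<?_; >-nonZero)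
open import Data.Nat.Properties
open import Data.Nat.Binary.Base using (ℕᵇ; 2[1+_]; 1+[2_]; fromℕ') renaming (zero to zeroᵇ; suc to sucᵇ; toℕ to toℕᵇ)
open import Data.Nat.Binary.Properties using (fromℕ≡fromℕ'; toℕ-fromℕ')
open import Data.Nat.Logarithm using (⌈log₂_⌉; ⌈log₂⌉-mono-≤; ⌈log₂2^n⌉≡n)
open import Data.Nat.Tactic.RingSolver using (solve-∀)
open import Data.Bool using (Bool; true; false; _∧_; _∨_; if_then_else_; T)
open import Data.Bool.Properties using (∨-zeroʳ)
open import Data.List using (List; []; _∷_; _++_; length; foldr; replicate; lookup)
open import Data.List.Properties using (length-++; ++-assoc; ++-identityʳ; length-replicate; length-++-sucʳ; length-++-≤ˡ)
open import Data.Vec as Vec using (Vec; toList)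
open import Data.Vec.Properties using (toList-cast)
open import Data.Fin using (Fin; #_; toℕ; fromℕ<; splitAt; _↑ˡ_; _↑ʳ_; combine; remQuot; finToFun; funToFin; cast)
  renaming (zero to fzero; suc to fsuc)
open import Data.Fin.Properties using (fromℕ<-toℕ; toℕ<n; toℕ-injective; toℕ-cast; ↑ˡ-injective; splitAt-↑ˡ; splitAt-↑ʳ;
  combine-injective; combine-remQuot; finToFun-funToFin; funToFin-finToFin; injective⇒≤)
open import Data.Fin.Permutation using (↔⇒≡)
open import Data.Maybe using (Maybe; just; nothing)
open import Data.Product using (Σ; _×_; _,_; proj₁; proj₂)
open import Data.Sum using (_⊎_; inj₁; inj₂; isInj₁)
open import Data.Unit using (tt)
open import Data.List.Relation.Unary.All using (All; []; _∷_)
import Data.List.Relation.Unary.All as All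
import Data.List.Relation.Unary.All.Properties as AllP
open import Data.Empty using (⊥; ⊥-elim)
open import Relation.Nullary using (¬_; yes; no)
open import Relation.Binary.PropositionalEquality
open import Function using (id; _∘_)
open import Function.Bundles using (_⇔_; mk⇔; _↔_; Inverse; Equivalence)
open import Function.Properties.Inverse using (↔-refl)

nth-++ˡ : ∀ {A : Set} (d : A) xs ys i → i < length xs → nth d (xs ++ ys) i ≡ nth d xs i
nth-++ˡ d (x ∷ xs) ys zero _ = refl
nth-++ˡ d (x ∷ xs) ys (suc i) (s≤s i<n) = nth-++ˡ d xs ys i i<n

nth-++ʳ : ∀ {A : Set} (d : A) xs ys i → nth d (xs ++ ys) (length xs + i) ≡ nth d ys i
nth-++ʳ d [] ys i = refl
nth-++ʳ d (x ∷ xs) ys i = nth-++ʳ d xs ys i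

nth-++-length : ∀ {A : Set} (d : A) xs ys → nth d (xs ++ ys) (length xs) ≡ nth d ys 0
nth-++-length d xs ys = trans (cong (nth d (xs ++ ys)) (sym (+-identityʳ (length xs)))) (nth-++ʳ d xs ys 0)

lastOr-snoc : ∀ {A : Set} (d : A) xs y → lastOr d (xs ++ y ∷ []) ≡ y
lastOr-snoc d [] y = refl
lastOr-snoc d (x ∷ xs) y = lastOr-snoc x xs y

scanGates : {A : Set} → (List A → Gate → A) → List A → Circuit → List A
scanGates f acc [] = acc
scanGates f acc (g ∷ gs) = scanGates f (acc ++ f acc g ∷ []) gs

scanGates-++ : ∀ {A : Set} (f : List A → Gate → A) acc xs ys →
  scanGates f acc (xs ++ ys) ≡ scanGates f (scanGates f acc xs) ys
scanGates-++ f acc [] ys = refl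
scanGates-++ f acc (g ∷ xs) ys = scanGates-++ f _ xs ys

gateVals≡scanGates : ∀ x acc gs → gateVals x acc gs ≡ scanGates (gateVal x) acc gs
gateVals≡scanGates x acc [] = refl
gateVals≡scanGates x acc (g ∷ gs) = gateVals≡scanGates x _ gs

gateDepths≡scanGates : ∀ acc gs → gateDepths acc gs ≡ scanGates gateDepth acc gs
gateDepths≡scanGates acc [] = refl
gateDepths≡scanGates acc (g ∷ gs) = gateDepths≡scanGates _ gs

WFGates-++ : ∀ m k xs ys → WFGates m k xs → WFGates m (k + length xs) ys → WFGates m k (xs ++ ys)
WFGates-++ m k [] ys _ wf = subst (λ j → WFGates m j ys) (+-identityʳ k) wf
WFGates-++ m k (input _ ∷ xs) ys (a , wf) wf′ = a , WFGates-++ m (suc k) xs ys wf (subst (λ j → WFGates m j ys) (+-suc k _) wf′)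
WFGates-++ m k (notG _ ∷ xs) ys (a , wf) wf′ = a , WFGates-++ m (suc k) xs ys wf (subst (λ j → WFGates m j ys) (+-suc k _) wf′)
WFGates-++ m k (andG _ ∷ xs) ys (a , wf) wf′ = a , WFGates-++ m (suc k) xs ys wf (subst (λ j → WFGates m j ys) (+-suc k _) wf′)
WFGates-++ m k (orG _ ∷ xs) ys (a , wf) wf′ = a , WFGates-++ m (suc k) xs ys wf (subst (λ j → WFGates m j ys) (+-suc k _) wf′)

-- Parent in the binary heap order 0; 1, 2; 3, 4, 5, 6; …  (the root is its own parent).
parent : ℕ → ℕ
parent zero = zero
parent (suc q) = ⌊ q /2⌋

parent≤ : ∀ q → parent q ≤ q
parent≤ zero = z≤n
parent≤ (suc q) = m≤n⇒m≤1+n (⌊n/2⌋≤n q)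

-- Gate 0 is the constant true; position p contributes gate 2p+1 reading input p
-- and gate 2p+2 testing input p together with the input at parent p.
pairGates : ℕ → Circuit
pairGates zero = []
pairGates (suc p) = pairGates p ++ input p ∷ andG (suc (2 * p) ∷ suc (2 * parent p) ∷ []) ∷ []

pairOutputs : ℕ → List ℕ
pairOutputs zero = []
pairOutputs (suc p) = suc (suc (2 * p)) ∷ pairOutputs p

-- For m = 0 the size bound (m + 1)² leaves room for one gate only, so the empty word is
-- accepted; the words that matter below are nonempty.
parentPairCircuit : ℕ → Circuit
parentPairCircuit zero = andG [] ∷ []
parentPairCircuit (suc k) = andG [] ∷ (pairGates (suc k) ++ orG (pairOutputs (suc k)) ∷ [])

length-pairGates : ∀ p → length (pairGates p) ≡ 2 * p
length-pairGates zero = refl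
length-pairGates (suc p) = begin
  length (pairGates p ++ _) ≡⟨ length-++ (pairGates p) ⟩
  length (pairGates p) + 2  ≡⟨ cong (_+ 2) (length-pairGates p) ⟩
  2 * p + 2                 ≡⟨ +-comm (2 * p) 2 ⟩
  2 + 2 * p                 ≡⟨ *-distribˡ-+ 2 1 p ⟨
  2 * suc p                 ∎
  where open ≡-Reasoning

size-parentPairCircuit : ∀ m → size (parentPairCircuit m) ≤ suc m ^ 2
size-parentPairCircuit zero = s≤s z≤n
size-parentPairCircuit (suc k) = begin
  suc (length (pairGates (suc k) ++ _)) ≡⟨ cong suc (length-++ (pairGates (suc k))) ⟩
  suc (length (pairGates (suc k)) + 1)  ≡⟨ cong (λ l → suc (l + 1)) (length-pairGates (suc k)) ⟩
  suc (2 * suc k + 1)                   ≡⟨ double k ⟩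
  2 * suc (suc k)                       ≤⟨ *-monoˡ-≤ (suc (suc k)) {2} {suc (suc k)} (s≤s (s≤s z≤n)) ⟩
  suc (suc k) * suc (suc k)             ≡⟨ cong (suc (suc k) *_) (sym (*-identityʳ (suc (suc k)))) ⟩
  suc (suc k) ^ 2                       ∎
  where
  open ≤-Reasoning
  double : ∀ k → suc (2 * suc k + 1) ≡ 2 * suc (suc k)
  double = solve-∀

WFGates-pairGates : ∀ m p → p ≤ m → WFGates m 1 (pairGates p)
WFGates-pairGates m zero _ = tt
WFGates-pairGates m (suc p) p<m = WFGates-++ m 1 (pairGates p) _ (WFGates-pairGates m p (<⇒≤ p<m))
  (subst (λ l → WFGates m (suc l) (input p ∷ andG (suc (2 * p) ∷ suc (2 * parent p) ∷ []) ∷ []))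
         (sym (length-pairGates p))
         (p<m , (n<1+n _ , s≤s (s≤s (*-monoʳ-≤ 2 (parent≤ p))) , tt) , tt))

All≤-pairOutputs : ∀ m p → p ≤ m → All≤ (pairOutputs p) (suc (2 * m))
All≤-pairOutputs m zero _ = tt
All≤-pairOutputs m (suc p) p<m =
  s≤s (subst (_≤ 2 * m) (*-suc 2 p) (*-monoʳ-≤ 2 p<m)) , All≤-pairOutputs m p (<⇒≤ p<m)

WF-parentPairCircuit : ∀ m → WF m (parentPairCircuit m)
WF-parentPairCircuit zero = s≤s z≤n , tt , tt
WF-parentPairCircuit (suc k) = s≤s z≤n , tt ,
  WFGates-++ (suc k) 1 (pairGates (suc k)) _ (WFGates-pairGates (suc k) (suc k) ≤-refl)
    (subst (λ l → WFGates (suc k) (suc l) (orG (pairOutputs (suc k)) ∷ [])) (sym (length-pairGates (suc k)))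
      (All≤-pairOutputs (suc k) (suc k) ≤-refl , tt))

interleave : {A : Set} → A → (ℕ → A) → (ℕ → A) → ℕ → List A
interleave a f g zero = a ∷ []
interleave a f g (suc p) = interleave a f g p ++ f p ∷ g p ∷ []

module _ {A : Set} (a : A) (f g : ℕ → A) where

  length-interleave : ∀ p → length (interleave a f g p) ≡ suc (2 * p)
  length-interleave zero = refl
  length-interleave (suc p) = begin
    length (interleave a f g p ++ _) ≡⟨ length-++ (interleave a f g p) ⟩
    length (interleave a f g p) + 2  ≡⟨ cong (_+ 2) (length-interleave p) ⟩
    suc (2 * p) + 2                  ≡⟨ double p ⟩
    suc (2 * suc p)                  ∎
    where
    open ≡-Reasoning
    double : ∀ p → suc (2 * p) + 2 ≡ suc (2 * suc p)
    double = solve-∀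

  private
    below : ∀ {i p} → i < suc (2 * p) → i < length (interleave a f g p)
    below {i} {p} = subst (i <_) (sym (length-interleave p))

  nth-interleave-odd : ∀ d p q → q < p → nth d (interleave a f g p) (suc (2 * q)) ≡ f q
  nth-interleave-odd d (suc p) q q<1+p with m≤n⇒m<n∨m≡n (≤-pred q<1+p)
  ... | inj₁ q<p = trans (nth-++ˡ d (interleave a f g p) _ _ (below {p = p} (s≤s (*-monoʳ-< 2 q<p)))) (nth-interleave-odd d p q q<p)
  ... | inj₂ refl = trans (cong (nth d (interleave a f g (suc q))) (sym (length-interleave q)))
                          (nth-++-length d (interleave a f g q) _)

  nth-interleave-even : ∀ d p q → q < p → nth d (interleave a f g p) (suc (suc (2 * q))) ≡ g q
  nth-interleave-even d (suc p) q q<1+p with m≤n⇒m<n∨m≡n (≤-pred q<1+p)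
  ... | inj₁ q<p = trans (nth-++ˡ d (interleave a f g p) _ _ (below {p = p} (s≤s (subst (_≤ 2 * p) (*-suc 2 q) (*-monoʳ-≤ 2 q<p)))))
                         (nth-interleave-even d p q q<p)
  ... | inj₂ refl = trans (cong (nth d (interleave a f g (suc q))) (trans (cong suc (sym (length-interleave q))) (+-comm 1 _)))
                          (nth-++ʳ d (interleave a f g q) _ 1)

  nth-interleave-snoc-odd : ∀ d p q → q ≤ p → nth d (interleave a f g p ++ f p ∷ []) (suc (2 * q)) ≡ f q
  nth-interleave-snoc-odd d p q q≤p with m≤n⇒m<n∨m≡n q≤p
  ... | inj₁ q<p = trans (nth-++ˡ d (interleave a f g p) _ _ (below {p = p} (s≤s (*-monoʳ-< 2 q<p)))) (nth-interleave-odd d p q q<p)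
  ... | inj₂ refl = trans (cong (nth d (interleave a f g q ++ f q ∷ [])) (sym (length-interleave q)))
                          (nth-++-length d (interleave a f g q) _)

  scanGates-pairGates : (step : List A → Gate → A) →
    (∀ acc q → step acc (input q) ≡ f q) →
    (∀ p → step (interleave a f g p ++ f p ∷ []) (andG (suc (2 * p) ∷ suc (2 * parent p) ∷ [])) ≡ g p) →
    ∀ p → scanGates step (a ∷ []) (pairGates p) ≡ interleave a f g p
  scanGates-pairGates step step-input step-and zero = refl
  scanGates-pairGates step step-input step-and (suc p) = begin
    scanGates step (a ∷ []) (pairGates p ++ gs)                       ≡⟨ scanGates-++ step _ (pairGates p) gs ⟩
    scanGates step (scanGates step (a ∷ []) (pairGates p)) gs          ≡⟨ cong (λ acc → scanGates step acc gs) (scanGates-pairGates step step-input step-and p) ⟩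
    (I ++ step I (input p) ∷ []) ++ step (I ++ step I (input p) ∷ []) and ∷ []
      ≡⟨ cong (λ b → (I ++ b ∷ []) ++ step (I ++ b ∷ []) and ∷ []) (step-input I p) ⟩
    (I ++ f p ∷ []) ++ step (I ++ f p ∷ []) and ∷ []                  ≡⟨ cong (λ b → (I ++ f p ∷ []) ++ b ∷ []) (step-and p) ⟩
    (I ++ f p ∷ []) ++ g p ∷ []                                       ≡⟨ ++-assoc I _ _ ⟩
    interleave a f g (suc p)                                          ∎
    where
    open ≡-Reasoning
    I = interleave a f g p
    and = andG (suc (2 * p) ∷ suc (2 * parent p) ∷ [])
    gs = input p ∷ and ∷ []

foldr-⊔-map-≤ : ∀ (f : ℕ → ℕ) js b → (∀ j → f j ≤ b) → foldr (λ j m → f j ⊔ m) 0 js ≤ b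
foldr-⊔-map-≤ f [] b _ = z≤n
foldr-⊔-map-≤ f (j ∷ js) b f≤b = ⊔-lub (f≤b j) (foldr-⊔-map-≤ f js b f≤b)

pairDepths : ℕ → List ℕ
pairDepths = interleave 1 (λ _ → 0) (λ _ → 1)

All-pairDepths : ∀ p → All (_≤ 1) (pairDepths p)
All-pairDepths zero = ≤-refl ∷ []
All-pairDepths (suc p) = AllP.++⁺ (All-pairDepths p) (z≤n ∷ ≤-refl ∷ [])

nth-≤ : ∀ {b} xs j → All (_≤ b) xs → nth 0 xs j ≤ b
nth-≤ [] j _ = z≤n
nth-≤ (x ∷ xs) zero (x≤b ∷ _) = x≤b
nth-≤ (x ∷ xs) (suc j) (_ ∷ xs≤b) = nth-≤ xs j xs≤b

foldr-⊔-≤ : ∀ {b} xs → All (_≤ b) xs → foldr _⊔_ 0 xs ≤ b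
foldr-⊔-≤ [] [] = z≤n
foldr-⊔-≤ (x ∷ xs) (x≤b ∷ xs≤b) = ⊔-lub x≤b (foldr-⊔-≤ xs xs≤b)

scanGates-gateDepth-pairGates : ∀ p → scanGates gateDepth (1 ∷ []) (pairGates p) ≡ pairDepths p
scanGates-gateDepth-pairGates = scanGates-pairGates 1 _ _ gateDepth (λ _ _ → refl) and-depth
  where
  and-depth : ∀ p → gateDepth (pairDepths p ++ 0 ∷ []) (andG (suc (2 * p) ∷ suc (2 * parent p) ∷ [])) ≡ 1
  and-depth p = cong₂ (λ a b → suc (a ⊔ (b ⊔ 0)))
    (nth-interleave-snoc-odd 1 _ _ 0 p p ≤-refl) (nth-interleave-snoc-odd 1 _ _ 0 p (parent p) (parent≤ p))

depth-parentPairCircuit : ∀ m → depth (parentPairCircuit m) ≤ 2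
depth-parentPairCircuit zero = s≤s z≤n
depth-parentPairCircuit (suc k) = subst (λ ds → foldr _⊔_ 0 ds ≤ 2) (sym depths)
  (foldr-⊔-≤ _ (AllP.++⁺ (All.map (λ d≤1 → ≤-trans d≤1 (n≤1+n 1)) (All-pairDepths (suc k)))
                        (s≤s (foldr-⊔-map-≤ (nth 0 D) (pairOutputs (suc k)) 1 (λ j → nth-≤ D j (All-pairDepths (suc k)))) ∷ [])))
  where
  D = pairDepths (suc k)
  depths : gateDepths [] (parentPairCircuit (suc k)) ≡ D ++ gateDepth D (orG (pairOutputs (suc k))) ∷ []
  depths = begin
    gateDepths (1 ∷ []) (pairGates (suc k) ++ orG (pairOutputs (suc k)) ∷ [])
      ≡⟨ gateDepths≡scanGates _ (pairGates (suc k) ++ _) ⟩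
    scanGates gateDepth (1 ∷ []) (pairGates (suc k) ++ orG (pairOutputs (suc k)) ∷ [])
      ≡⟨ scanGates-++ gateDepth _ (pairGates (suc k)) _ ⟩
    scanGates gateDepth (scanGates gateDepth (1 ∷ []) (pairGates (suc k))) (orG (pairOutputs (suc k)) ∷ [])
      ≡⟨ cong (λ ds → scanGates gateDepth ds (orG (pairOutputs (suc k)) ∷ [])) (scanGates-gateDepth-pairGates (suc k)) ⟩
    D ++ gateDepth D (orG (pairOutputs (suc k))) ∷ [] ∎
    where open ≡-Reasoning

module _ (z : List Bool) where

  pairAt : ℕ → Bool
  pairAt q = nth false z q ∧ (nth false z (parent q) ∧ true)

  anyParentPair : ℕ → Bool
  anyParentPair zero = false
  anyParentPair (suc q) = pairAt q ∨ anyParentPair q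

  ParentPairBelow : ℕ → Set
  ParentPairBelow p = Σ ℕ λ q → q < p × nth false z q ≡ true × nth false z (parent q) ≡ true

  eval-parentPairCircuit : ∀ k → eval (parentPairCircuit (suc k)) z ≡ anyParentPair (suc k)
  eval-parentPairCircuit k = begin
    lastOr false (gateVals z (true ∷ []) (pairGates (suc k) ++ orG outs ∷ []))
      ≡⟨ cong (lastOr false) (gateVals≡scanGates z _ (pairGates (suc k) ++ _)) ⟩
    lastOr false (scanGates (gateVal z) (true ∷ []) (pairGates (suc k) ++ orG outs ∷ []))
      ≡⟨ cong (lastOr false) (scanGates-++ (gateVal z) _ (pairGates (suc k)) _) ⟩
    lastOr false (scanGates (gateVal z) (scanGates (gateVal z) (true ∷ []) (pairGates (suc k))) (orG outs ∷ []))
      ≡⟨ cong (λ vs → lastOr false (scanGates (gateVal z) vs (orG outs ∷ []))) values ⟩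
    lastOr false (V ++ gateVal z V (orG outs) ∷ [])
      ≡⟨ lastOr-snoc false V _ ⟩
    foldr (λ j b → nth false V j ∨ b) false (pairOutputs (suc k))
      ≡⟨ outputs (suc k) ≤-refl ⟩
    anyParentPair (suc k) ∎
    where
    open ≡-Reasoning
    outs = pairOutputs (suc k)
    V = interleave true (nth false z) pairAt (suc k)
    values : scanGates (gateVal z) (true ∷ []) (pairGates (suc k)) ≡ V
    values = scanGates-pairGates true _ _ (gateVal z) (λ _ _ → refl)
      (λ p → cong₂ (λ a b → a ∧ (b ∧ true)) (nth-interleave-snoc-odd true _ _ false p p ≤-refl)
                                              (nth-interleave-snoc-odd true _ _ false p (parent p) (parent≤ p)))
      (suc k)
    outputs : ∀ p → p ≤ suc k → foldr (λ j b → nth false V j ∨ b) false (pairOutputs p) ≡ anyParentPair p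
    outputs zero _ = refl
    outputs (suc p) p<k = cong₂ _∨_ (nth-interleave-even true _ _ false (suc k) p p<k) (outputs p (<⇒≤ p<k))

  anyParentPair⇔ParentPairBelow : ∀ p → anyParentPair p ≡ true ⇔ ParentPairBelow p
  anyParentPair⇔ParentPairBelow p = mk⇔ (to p) (λ (q , q<p , zq , zpq) → from p q q<p zq zpq)
    where
    to : ∀ p → anyParentPair p ≡ true → ParentPairBelow p
    to (suc p) any with nth false z p in zp | nth false z (parent p) in zpp | anyParentPair p in rest
    ... | true  | true  | _    = p , ≤-refl , zp , zpp
    ... | true  | false | true = let (q , q<p , zq , zpq) = to p rest in q , m≤n⇒m≤1+n q<p , zq , zpq
    ... | false | _     | true = let (q , q<p , zq , zpq) = to p rest in q , m≤n⇒m≤1+n q<p , zq , zpq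
    from : ∀ p q → q < p → nth false z q ≡ true → nth false z (parent q) ≡ true → anyParentPair p ≡ true
    from (suc p) q q<1+p zq zpq with m≤n⇒m<n∨m≡n (≤-pred q<1+p)
    ... | inj₂ refl = cong (_∨ anyParentPair q) (cong₂ (λ a b → a ∧ (b ∧ true)) zq zpq)
    ... | inj₁ q<p  = trans (cong (pairAt p ∨_) (from p q q<p zq zpq)) (∨-zeroʳ (pairAt p))

ParentPair : Language
ParentPair w = eval (parentPairCircuit (length w)) w ≡ true

ParentPair⇔ParentPairBelow : ∀ w {k} → length w ≡ suc k → ParentPair w ⇔ ParentPairBelow w (suc k)
ParentPair⇔ParentPairBelow w {k} |w| rewrite |w| =
  subst (λ b → (b ≡ true) ⇔ ParentPairBelow w (suc k)) (sym (eval-parentPairCircuit w k)) (anyParentPair⇔ParentPairBelow w (suc k))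

extend : ∀ {k} → (Fin k → Bool) → ℕ → Bool
extend {k} f a with a <? k
... | yes a<k = f (fromℕ< a<k)
... | no _ = false

extend-toℕ : ∀ {k} (f : Fin k → Bool) i → extend f (toℕ i) ≡ f i
extend-toℕ {k} f i with toℕ i <? k
... | yes i<k = cong f (fromℕ<-toℕ i i<k)
... | no i≮k = ⊥-elim (i≮k (toℕ<n i))

extend-true : ∀ {k} (f : Fin k → Bool) a → extend f a ≡ true → a < k
extend-true {k} f a fa with a <? k
... | yes a<k = a<k

shift : ℕ → (ℕ → Bool) → ℕ → Bool
shift zero f a = f a
shift (suc o) f zero = false
shift (suc o) f (suc a) = shift o f a

shift-+ : ∀ o f a → shift o f (o + a) ≡ f a
shift-+ zero f a = refl
shift-+ (suc o) f a = shift-+ o f a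

shift-true : ∀ o f a → shift o f a ≡ true → Σ ℕ λ b → a ≡ o + b × f b ≡ true
shift-true zero f a fa = a , refl , fa
shift-true (suc o) f (suc a) fa with shift-true o f a fa
... | b , refl , fb = b , refl , fb

bits : (ℕ → Bool) → (n : ℕ) → Vec Bool n
bits f zero = Vec.[]
bits f (suc n) = f 0 Vec.∷ bits (f ∘ suc) n

length-bits : ∀ f n → length (toList (bits f n)) ≡ n
length-bits f zero = refl
length-bits f (suc n) = cong suc (length-bits (f ∘ suc) n)

nth-bits : ∀ f n q → q < n → nth false (toList (bits f n)) q ≡ f q
nth-bits f (suc n) zero _ = refl
nth-bits f (suc n) (suc q) (s≤s q<n) = nth-bits (f ∘ suc) n q q<n

≡ᵇ-true : ∀ a b → (a ≡ᵇ b) ≡ true → a ≡ b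
≡ᵇ-true a b a≡ᵇb = ≡ᵇ⇒≡ a b (subst T (sym a≡ᵇb) tt)

≡ᵇ-false : ∀ a b → a ≢ b → (a ≡ᵇ b) ≡ false
≡ᵇ-false a b a≢b with a ≡ᵇ b in eq
... | true = ⊥-elim (a≢b (≡ᵇ-true a b eq))
... | false = refl

≡ᵇ-refl : ∀ a → (a ≡ᵇ a) ≡ true
≡ᵇ-refl zero = refl
≡ᵇ-refl (suc a) = ≡ᵇ-refl a

⌊2*a+r/2⌋ : ∀ a r → ⌊ 2 * a + r /2⌋ ≡ a + ⌊ r /2⌋
⌊2*a+r/2⌋ zero r = refl
⌊2*a+r/2⌋ (suc a) r = trans (cong (λ x → ⌊ x + r /2⌋) (*-suc 2 a)) (cong suc (⌊2*a+r/2⌋ a r))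

⌊2*a/2⌋ : ∀ a → ⌊ 2 * a /2⌋ ≡ a
⌊2*a/2⌋ a = trans (cong ⌊_/2⌋ (sym (+-identityʳ (2 * a)))) (trans (⌊2*a+r/2⌋ a 0) (+-identityʳ a))

parent-2*suc : ∀ a → parent (2 * suc a) ≡ a
parent-2*suc a = trans (cong parent (*-suc 2 a)) (trans (cong ⌊_/2⌋ (sym (+-comm (2 * a) 1))) (trans (⌊2*a+r/2⌋ a 1) (+-identityʳ a)))

n<2^n : ∀ n → n < 2 ^ n
n<2^n zero = s≤s z≤n
n<2^n (suc n) = ≤-trans (s≤s (n<2^n n))
  (subst (_≤ 2 ^ suc n) (+-comm (2 ^ n) 1) (+-monoʳ-≤ (2 ^ n) (subst (1 ≤_) (sym (+-identityʳ (2 ^ n))) (m^n>0 2 n))))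

adjᴹ : (G : Graph) → Maybe (Fin (n G)) → Maybe (Fin (n G)) → Bool
adjᴹ G (just u) (just v) = adj G u v
adjᴹ G (just u) nothing = false
adjᴹ G nothing _ = false

adjᴹ-sym : ∀ G x y → adjᴹ G x y ≡ adjᴹ G y x
adjᴹ-sym G (just u) (just v) = Graph.sym G u v
adjᴹ-sym G (just u) nothing = refl
adjᴹ-sym G nothing (just v) = refl
adjᴹ-sym G nothing nothing = refl

adjᴹ-irrefl : ∀ G x → adjᴹ G x x ≡ false
adjᴹ-irrefl G (just u) = irrefl G u
adjᴹ-irrefl G nothing = refl

unpad : ∀ k p → Fin (k + p) → Maybe (Fin k)
unpad k p u = isInj₁ (splitAt k u)

padWith : Graph → ℕ → Graph
padWith G p = record
  { n = n G + p
  ; adj = λ u v → adjᴹ G (unpad (n G) p u) (unpad (n G) p v)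
  ; sym = λ u v → adjᴹ-sym G (unpad (n G) p u) (unpad (n G) p v)
  ; irrefl = λ u → adjᴹ-irrefl G (unpad (n G) p u) }

adj-padWith-↑ˡ : ∀ G p u v → adj (padWith G p) (u ↑ˡ p) (v ↑ˡ p) ≡ adj G u v
adj-padWith-↑ˡ G p u v rewrite splitAt-↑ˡ (n G) u p | splitAt-↑ˡ (n G) v p = refl

-- Vertex u gets the id a = 1 + toℕ u.  Its label of length h = 2g + 1 has a 1 at
-- position 2a, and at position g + b whenever b is the id of a neighbour.  In the
-- concatenated labels of u and v the position h + 2·(id v) has parent g + id v,
-- so a parent pair occurs exactly when u and v are adjacent; the gap between 2k
-- and g rules out parent pairs inside a single label.
module ParentPairLabels (G : Graph) where

  k : ℕ
  k = n G

  g : ℕ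
  g = 4 * k + 2

  h : ℕ
  h = suc (2 * g)

  nbr : Fin k → ℕ → Bool
  nbr u zero = false
  nbr u (suc a) = extend (adj G u) a

  bit : Maybe (Fin k) → ℕ → Bool
  bit nothing p = false
  bit (just u) p = (p ≡ᵇ 2 * suc (toℕ u)) ∨ shift g (nbr u) p

  word : Maybe (Fin k) → Maybe (Fin k) → List Bool
  word x y = toList (bits (bit x) h) ++ toList (bits (bit y) h)

  private
    g≡ : g ≡ 2 * (2 * k + 1)
    g≡ = e k where e : ∀ k → 4 * k + 2 ≡ 2 * (2 * k + 1)
                   e = solve-∀

    2k<g : 2 * k < g
    2k<g = subst (2 * k <_) (e k) (m≤m+n (suc (2 * k)) (2 * k + 1))
      where e : ∀ k → suc (2 * k) + (2 * k + 1) ≡ 4 * k + 2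
            e = solve-∀

    id≤k : ∀ u → suc (toℕ u) ≤ k
    id≤k u = toℕ<n u

    2id<g : ∀ u → 2 * suc (toℕ u) < g
    2id<g u = ≤-<-trans (*-monoʳ-≤ 2 (id≤k u)) 2k<g

    g+a<h : ∀ a → a ≤ g → g + a < h
    g+a<h a a≤g = s≤s (+-monoʳ-≤ g (subst (a ≤_) (sym (+-identityʳ g)) a≤g))

    nbr-true : ∀ u a → nbr u a ≡ true → 1 ≤ a × a ≤ k
    nbr-true u (suc a) na = s≤s z≤n , extend-true (adj G u) a na

  bit-true : ∀ u p → bit (just u) p ≡ true →
    p ≡ 2 * suc (toℕ u) ⊎ Σ ℕ λ a → p ≡ g + a × nbr u a ≡ true
  bit-true u p bp with p ≡ᵇ 2 * suc (toℕ u) in eq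
  ... | true = inj₁ (≡ᵇ-true p _ eq)
  ... | false = inj₂ (shift-true g (nbr u) p bp)

  bit-id : ∀ u → bit (just u) (2 * suc (toℕ u)) ≡ true
  bit-id u = cong (_∨ shift g (nbr u) (2 * suc (toℕ u))) (≡ᵇ-refl (2 * suc (toℕ u)))

  bit-nbr : ∀ u a → bit (just u) (g + a) ≡ nbr u a
  bit-nbr u a = cong₂ _∨_ (≡ᵇ-false _ _ (λ e → <⇒≱ (2id<g u) (subst (g ≤_) e (m≤m+n g a)))) (shift-+ g (nbr u) a)

  nth-word-low : ∀ x y q → q < h → nth false (word x y) q ≡ bit x q
  nth-word-low x y q q<h = trans (nth-++ˡ false _ _ q (subst (q <_) (sym (length-bits (bit x) h)) q<h)) (nth-bits (bit x) h q q<h)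

  nth-word-high : ∀ x y r → r < h → nth false (word x y) (h + r) ≡ bit y r
  nth-word-high x y r r<h = trans (cong (λ l → nth false (word x y) (l + r)) (sym (length-bits (bit x) h)))
                                  (trans (nth-++ʳ false (toList (bits (bit x) h)) _ r) (nth-bits (bit y) h r r<h))

  parent-high : ∀ r → parent (h + r) ≡ g + ⌊ r /2⌋
  parent-high r = ⌊2*a+r/2⌋ g r

  no-pair-in-label : ∀ x q → bit x q ≡ true → bit x (parent q) ≡ true → ⊥
  no-pair-in-label (just u) q bq bpq with bit-true u q bq
  ... | inj₁ refl = id-case (bit-true u _ (subst (λ p → bit (just u) p ≡ true) (parent-2*suc (toℕ u)) bpq))
    where
    i = toℕ u
    id-case : i ≡ 2 * suc i ⊎ Σ ℕ (λ a → i ≡ g + a × nbr u a ≡ true) → ⊥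
    id-case (inj₁ e) = <-irrefl e (≤-trans (n<1+n i) (m≤m+n (suc i) _))
    id-case (inj₂ (a , e , _)) = <⇒≱ (<-≤-trans (toℕ<n u) (≤-trans (m≤n*m k 2) (<⇒≤ 2k<g))) (subst (g ≤_) (sym e) (m≤m+n g a))
  ... | inj₂ (suc a , refl , na) = nbr-case (bit-true u P (subst (λ p → bit (just u) p ≡ true) parent≡ bpq))
    where
    P = (2 * k + 1) + ⌊ a /2⌋
    parent≡ : parent (g + suc a) ≡ P
    parent≡ = trans (cong parent (+-suc g a)) (trans (cong (λ x → ⌊ x + a /2⌋) g≡) (⌊2*a+r/2⌋ (2 * k + 1) a))
    2k<P : 2 * k < P
    2k<P = ≤-trans (≤-reflexive (+-comm 1 (2 * k))) (m≤m+n (2 * k + 1) _)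
    P<g : P < g
    P<g = begin-strict
      (2 * k + 1) + ⌊ a /2⌋ ≤⟨ +-monoʳ-≤ (2 * k + 1) (⌊n/2⌋≤n a) ⟩
      (2 * k + 1) + a       <⟨ +-monoʳ-< (2 * k + 1) (proj₂ (nbr-true u (suc a) na)) ⟩
      (2 * k + 1) + k       ≤⟨ subst ((2 * k + 1) + k ≤_) (e k) (m≤m+n _ (k + 1)) ⟩
      g                     ∎
      where
      open ≤-Reasoning
      e : ∀ k → (2 * k + 1) + k + (k + 1) ≡ 4 * k + 2
      e = solve-∀
    nbr-case : P ≡ 2 * suc (toℕ u) ⊎ Σ ℕ (λ b → P ≡ g + b × nbr u b ≡ true) → ⊥
    nbr-case (inj₁ e) = <⇒≱ 2k<P (subst (_≤ 2 * k) (sym e) (*-monoʳ-≤ 2 (id≤k u)))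
    nbr-case (inj₂ (b , e , _)) = <⇒≱ P<g (subst (g ≤_) (sym e) (m≤m+n g b))

  cross-pair : ∀ x y r → bit y r ≡ true → bit x (g + ⌊ r /2⌋) ≡ true → adjᴹ G x y ≡ true
  cross-pair (just u) (just v) r br bx with bit-true v r br
  ... | inj₁ refl = begin
    adj G u v                               ≡⟨ extend-toℕ (adj G u) v ⟨
    nbr u (suc (toℕ v))                     ≡⟨ cong (nbr u) (⌊2*a/2⌋ (suc (toℕ v))) ⟨
    nbr u ⌊ 2 * suc (toℕ v) /2⌋             ≡⟨ bit-nbr u _ ⟨
    bit (just u) (g + ⌊ 2 * suc (toℕ v) /2⌋) ≡⟨ bx ⟩
    true                                    ∎
    where open ≡-Reasoning
  ... | inj₂ (b , refl , _) = ⊥-elim (<⇒≱ k<half (proj₂ (nbr-true u _ (trans (sym (bit-nbr u _)) bx))))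
    where
    k<half : k < ⌊ g + b /2⌋
    k<half = subst (k <_) (sym (trans (cong (λ x → ⌊ x + b /2⌋) g≡) (⌊2*a+r/2⌋ (2 * k + 1) b)))
                   (≤-trans (s≤s (m≤m+n k (k + 0))) (≤-trans (≤-reflexive (+-comm 1 (2 * k))) (m≤m+n (2 * k + 1) _)))

  adjᴹ⇔ParentPairBelow : ∀ x y → adjᴹ G x y ≡ true ⇔ ParentPairBelow (word x y) (h + h)
  adjᴹ⇔ParentPairBelow x y = mk⇔ (adj→pair x y) (pair→adj x y)
    where
    adj→pair : ∀ x y → adjᴹ G x y ≡ true → ParentPairBelow (word x y) (h + h)
    adj→pair (just u) (just v) uv = h + 2 * a , +-monoʳ-< h 2a<h , bit-at-q , bit-at-parent
      where
      a = suc (toℕ v)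
      2a<h : 2 * a < h
      2a<h = <-trans (2id<g v) (s≤s (m≤m+n g (g + 0)))
      bit-at-q = trans (nth-word-high (just u) (just v) (2 * a) 2a<h) (bit-id v)
      bit-at-parent = begin
        nth false (word (just u) (just v)) (parent (h + 2 * a)) ≡⟨ cong (nth false (word (just u) (just v))) (trans (parent-high (2 * a)) (cong (g +_) (⌊2*a/2⌋ a))) ⟩
        nth false (word (just u) (just v)) (g + a)              ≡⟨ nth-word-low (just u) (just v) (g + a) (g+a<h a a≤g) ⟩
        bit (just u) (g + a)                                    ≡⟨ bit-nbr u a ⟩
        extend (adj G u) (toℕ v)                                ≡⟨ extend-toℕ (adj G u) v ⟩
        adj G u v                                               ≡⟨ uv ⟩
        true                                                    ∎
        where
        open ≡-Reasoning
        a≤g : a ≤ g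
        a≤g = ≤-trans (id≤k v) (≤-trans (m≤n*m k 2) (<⇒≤ 2k<g))
    pair→adj : ∀ x y → ParentPairBelow (word x y) (h + h) → adjᴹ G x y ≡ true
    pair→adj x y (q , q<2h , zq , zpq) with q <? h
    ... | yes q<h = ⊥-elim (no-pair-in-label x q (trans (sym (nth-word-low x y q q<h)) zq)
                                                 (trans (sym (nth-word-low x y _ (≤-<-trans (parent≤ q) q<h))) zpq))
    ... | no q≮h = cross-pair x y r (trans (sym (nth-word-high x y r r<h)) (trans (cong (nth false (word x y)) h+r≡q) zq))
                     (trans (sym (nth-word-low x y _ parent<h)) (trans (cong (nth false (word x y)) parent≡) zpq))
      where
      r = q ∸ h
      h+r≡q : h + r ≡ q
      h+r≡q = m+[n∸m]≡n (≮⇒≥ q≮h)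
      r<h : r < h
      r<h = +-cancelˡ-< h r h (subst (_< h + h) (sym h+r≡q) q<2h)
      parent≡ : g + ⌊ r /2⌋ ≡ parent q
      parent≡ = trans (sym (parent-high r)) (cong parent h+r≡q)
      parent<h : g + ⌊ r /2⌋ < h
      parent<h = g+a<h _ (subst (⌊ r /2⌋ ≤_) (⌊2*a/2⌋ g) (⌊n/2⌋-mono (≤-pred r<h)))

  adjᴹ⇔F[ParentPair] : ∀ x y → adjᴹ G x y ≡ true ⇔ F[ ParentPair ] (toList (bits (bit x) h)) (toList (bits (bit y) h))
  adjᴹ⇔F[ParentPair] x y = mk⇔
    (λ xy → trans (length-bits (bit x) h) (sym (length-bits (bit y) h)) ,
            Equivalence.from word⇔ (Equivalence.to (adjᴹ⇔ParentPairBelow x y) xy))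
    (λ (_ , w) → Equivalence.from (adjᴹ⇔ParentPairBelow x y) (Equivalence.to word⇔ w))
    where
    |word| : length (word x y) ≡ suc (2 * g + h)
    |word| = trans (length-++ (toList (bits (bit x) h))) (cong₂ _+_ (length-bits (bit x) h) (length-bits (bit y) h))
    word⇔ : ParentPair (word x y) ⇔ ParentPairBelow (word x y) (h + h)
    word⇔ = ParentPair⇔ParentPairBelow (word x y) |word|

  padding : ℕ
  padding = 2 ^ h ∸ k

  padded : Graph
  padded = padWith G padding

  log-padded : 1 * ⌈log₂ (k + padding) ⌉ ≡ h
  log-padded = trans (*-identityˡ _) (trans (cong ⌈log₂_⌉ (m+[n∸m]≡n k≤2^h)) (⌈log₂2^n⌉≡n h))
    where
    k≤2^h : k ≤ 2 ^ h
    k≤2^h = ≤-trans (m≤n*m k 2) (≤-trans (<⇒≤ 2k<g) (≤-trans (m≤m+n g (g + 0)) (≤-trans (n≤1+n _) (<⇒≤ (n<2^n h)))))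

  padded∈gr : InGr F[ ParentPair ] 1 padded
  padded∈gr = (λ u → bits (bit (unpad k padding u)) (1 * ⌈log₂ (k + padding) ⌉)) ,
              (λ u v → labels-correct log-padded (unpad k padding u) (unpad k padding v))
    where
    labels-correct : ∀ {l} → l ≡ h → ∀ x y → adjᴹ G x y ≡ true ⇔ F[ ParentPair ] (toList (bits (bit x) l)) (toList (bits (bit y) l))
    labels-correct refl = adjᴹ⇔F[ParentPair]

InGr-iso : ∀ F c G H → Iso G H → InGr F c G → InGr F c H
InGr-iso F c G H (π , preserves) (ℓ , ℓ-correct) = ℓ′ , ℓ′-correct
  where
  open Inverse π using (from; strictlyInverseˡ)
  ℓ′ : Fin (n H) → Vec Bool (c * ⌈log₂ (n H) ⌉)
  ℓ′ v = Vec.cast (cong (λ k → c * ⌈log₂ k ⌉) (↔⇒≡ π)) (ℓ (from v))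
  adj-from : ∀ u v → adj H u v ≡ adj G (from u) (from v)
  adj-from u v = trans (cong₂ (adj H) (sym (strictlyInverseˡ u)) (sym (strictlyInverseˡ v))) (preserves (from u) (from v))
  ℓ′-correct : ∀ u v → (adj H u v ≡ true) ⇔ F (toList (ℓ′ u)) (toList (ℓ′ v))
  ℓ′-correct u v = mk⇔
    (λ uv → subst₂ F (sym (toList-cast _ _)) (sym (toList-cast _ _))
                     (Equivalence.to (ℓ-correct (from u) (from v)) (trans (sym (adj-from u v)) uv)))
    (λ Fuv → trans (adj-from u v) (Equivalence.from (ℓ-correct (from u) (from v))
                                    (subst₂ F (toList-cast _ _) (toList-cast _ _) Fuv)))

𝒞 : GraphClass
𝒞 = record { member = InGr F[ ParentPair ] 1 ; iso-closed = InGr-iso F[ ParentPair ] 1 }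

induced-padWith-Iso : ∀ G p → Iso (induced (padWith G p) (n G) (_↑ˡ p)) G
induced-padWith-Iso G p = ↔-refl , λ u v → sym (adj-padWith-↑ˡ G p u v)

hereditary-⊇𝒞⇒universal : ∀ D → Hereditary D → 𝒞 ⊆ᶜ D → ∀ G → member D G
hereditary-⊇𝒞⇒universal D hereditary 𝒞⊆D G = iso-closed D _ G (induced-padWith-Iso G padding)
  (hereditary padded (n G) (_↑ˡ padding) (↑ˡ-injective padding _ _) (𝒞⊆D padded padded∈gr))
  where open ParentPairLabels G

-- The covering relation of AtMostClasses is local to its definition; it is recovered by unification.
coveredBy : ∀ {D k m} {AnyIso : Graph → List Graph → Set} (X : Set) →
  X ≡ Σ (List Graph) (λ reps → length reps ≤ k × (∀ G → n G ≡ m → member D G → AnyIso G reps)) →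
  Graph → List Graph → Set
coveredBy {AnyIso = AnyIso} _ _ = AnyIso

representatives : ∀ {D k m} → AtMostClasses D k m → Σ (List Graph) λ reps → length reps ≤ k ×
  (∀ G → n G ≡ m → member D G → Σ (Fin (length reps)) λ i → Iso G (lookup reps i))
representatives {D} {k} {m} (reps , |reps| , cover) = reps , |reps| , λ G |G| G∈D → find G reps (cover G |G| G∈D)
  where
  find : ∀ G reps → coveredBy {D} {k} {m} (AtMostClasses D k m) refl G reps →
    Σ (Fin (length reps)) λ i → Iso G (lookup reps i)
  find G (H ∷ Hs) (inj₁ iso) = fzero , iso
  find G (H ∷ Hs) (inj₂ any) = let (i , iso) = find G Hs any in fsuc i , iso

adj-cong : ∀ (R R′ : Graph) → R ≡ R′ → ∀ {m} (f : Fin m → Fin (n R)) (f′ : Fin m → Fin (n R′)) →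
  (∀ u → toℕ (f u) ≡ toℕ (f′ u)) → ∀ u v → adj R (f u) (f v) ≡ adj R′ (f′ u) (f′ v)
adj-cong R .R refl f f′ f≗f′ u v = cong₂ (adj R) (toℕ-injective (f≗f′ u)) (toℕ-injective (f≗f′ v))

-- A labelled graph on Fin m is determined by its representative and an m-vertex relabelling.
labelled≤representatives*relabellings : ∀ {N m} (G : Fin N → Graph) (f : ∀ s → Fin m → Fin (n (G s)))
  (reps : List Graph) → (∀ s → Σ (Fin (length reps)) λ i → Iso (induced (G s) m (f s)) (lookup reps i)) →
  (∀ s s′ → (∀ u v → adj (G s) (f s u) (f s v) ≡ adj (G s′) (f s′ u) (f s′ v)) → s ≡ s′) →
  N ≤ length reps * m ^ m
labelled≤representatives*relabellings {N} {m} G f reps rep distinct = injective⇒≤ code-injective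
  where
  π : ∀ s → Fin m ↔ Fin (n (lookup reps (proj₁ (rep s))))
  π s = proj₁ (proj₂ (rep s))
  relabel : ∀ s → Fin m → Fin m
  relabel s u = cast (sym (↔⇒≡ (π s))) (Inverse.to (π s) u)
  code : Fin N → Fin (length reps * m ^ m)
  code s = combine (proj₁ (rep s)) (funToFin (relabel s))
  code-injective : ∀ {s s′} → code s ≡ code s′ → s ≡ s′
  code-injective {s} {s′} eq = distinct s s′ λ u v → trans (sym (proj₂ (proj₂ (rep s)) u v))
    (trans (adj-cong _ _ (cong (lookup reps) same-rep) (Inverse.to (π s)) (Inverse.to (π s′)) same-relabel u v)
           (proj₂ (proj₂ (rep s′)) u v))
    where
    same-rep : proj₁ (rep s) ≡ proj₁ (rep s′)
    same-rep = proj₁ (combine-injective (proj₁ (rep s)) (funToFin (relabel s)) (proj₁ (rep s′)) (funToFin (relabel s′)) eq)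
    same-relabel : ∀ u → toℕ (Inverse.to (π s) u) ≡ toℕ (Inverse.to (π s′) u)
    same-relabel u = begin
      toℕ (Inverse.to (π s) u)   ≡⟨ toℕ-cast _ (Inverse.to (π s) u) ⟨
      toℕ (relabel s u)          ≡⟨ cong toℕ (finToFun-funToFin (relabel s) u) ⟨
      toℕ (finToFun (funToFin (relabel s)) u)  ≡⟨ cong (λ c → toℕ (finToFun c u)) (proj₂ (combine-injective (proj₁ (rep s)) (funToFin (relabel s)) (proj₁ (rep s′)) (funToFin (relabel s′)) eq)) ⟩
      toℕ (finToFun (funToFin (relabel s′)) u) ≡⟨ cong toℕ (finToFun-funToFin (relabel s′) u) ⟩
      toℕ (relabel s′ u)         ≡⟨ toℕ-cast _ (Inverse.to (π s′) u) ⟩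
      toℕ (Inverse.to (π s′) u)  ∎
      where open ≡-Reasoning

bipartiteAdj : ∀ {t} → (Fin t → Fin t → Bool) → Fin t ⊎ Fin t → Fin t ⊎ Fin t → Bool
bipartiteAdj M (inj₁ i) (inj₂ j) = M i j
bipartiteAdj M (inj₂ j) (inj₁ i) = M i j
bipartiteAdj M (inj₁ _) (inj₁ _) = false
bipartiteAdj M (inj₂ _) (inj₂ _) = false

bipartiteAdj-sym : ∀ {t} (M : Fin t → Fin t → Bool) x y → bipartiteAdj M x y ≡ bipartiteAdj M y x
bipartiteAdj-sym M (inj₁ i) (inj₂ j) = refl
bipartiteAdj-sym M (inj₂ j) (inj₁ i) = refl
bipartiteAdj-sym M (inj₁ _) (inj₁ _) = refl
bipartiteAdj-sym M (inj₂ _) (inj₂ _) = refl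

bipartiteAdj-irrefl : ∀ {t} (M : Fin t → Fin t → Bool) x → bipartiteAdj M x x ≡ false
bipartiteAdj-irrefl M (inj₁ _) = refl
bipartiteAdj-irrefl M (inj₂ _) = refl

bipartite : ∀ t → (Fin t → Fin t → Bool) → Graph
bipartite t M = record
  { n = t + t
  ; adj = λ u v → bipartiteAdj M (splitAt t u) (splitAt t v)
  ; sym = λ u v → bipartiteAdj-sym M (splitAt t u) (splitAt t v)
  ; irrefl = λ u → bipartiteAdj-irrefl M (splitAt t u) }

adj-bipartite : ∀ t M i j → adj (bipartite t M) (i ↑ˡ t) (t ↑ʳ j) ≡ M i j
adj-bipartite t M i j rewrite splitAt-↑ˡ t i t | splitAt-↑ʳ t t j = refl

funToFin-cong : ∀ {m k} {f g : Fin m → Fin k} → (∀ x → f x ≡ g x) → funToFin f ≡ funToFin g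
funToFin-cong {zero} _ = refl
funToFin-cong {suc m} f≗g = cong₂ combine (f≗g fzero) (funToFin-cong (f≗g ∘ fsuc))

toBool : Fin 2 → Bool
toBool fzero = false
toBool (fsuc _) = true

toBool-injective : ∀ {a b} → toBool a ≡ toBool b → a ≡ b
toBool-injective {fzero} {fzero} _ = refl
toBool-injective {fsuc fzero} {fsuc fzero} _ = refl

matrix : ∀ t → Fin (2 ^ (t * t)) → Fin t → Fin t → Bool
matrix t s i j = toBool (finToFun s (combine i j))

matrix-injective : ∀ t s s′ → (∀ i j → matrix t s i j ≡ matrix t s′ i j) → s ≡ s′
matrix-injective t s s′ same = begin
  s                          ≡⟨ funToFin-finToFin {t * t} {2} s ⟨
  funToFin {t * t} (finToFun s)  ≡⟨ funToFin-cong same-entries ⟩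
  funToFin {t * t} (finToFun s′) ≡⟨ funToFin-finToFin {t * t} {2} s′ ⟩
  s′                         ∎
  where
  open ≡-Reasoning
  same-entries : ∀ c → finToFun s c ≡ finToFun s′ c
  same-entries c = subst (λ c → finToFun s c ≡ finToFun s′ c) (combine-remQuot {t} t c)
    (toBool-injective (same (proj₁ (remQuot {t} t c)) (proj₂ (remQuot {t} t c))))


n²≤2ⁿ : ∀ e → (4 + e) * (4 + e) ≤ 2 ^ (4 + e)
n²≤2ⁿ zero = ≤-refl
n²≤2ⁿ (suc e) = ≤-trans (subst ((5 + e) * (5 + e) ≤_) (double e) (m≤m+n _ _)) (*-monoʳ-≤ 2 (n²≤2ⁿ e))
  where
  double : ∀ e → (5 + e) * (5 + e) + (e * e + 6 * e + 7) ≡ 2 * ((4 + e) * (4 + e))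
  double = solve-∀

universal⇒¬Small : ∀ D → (∀ G → member D G) → ¬ Small D
universal⇒¬Small D universal (c , N , small) = <⇒≱ too-few graphs≤
  where
  d = suc c
  j = 2 * d + 4 + N
  t = 2 ^ j
  m = t + t

  N≤m : N ≤ m
  N≤m = ≤-trans (m≤n+m N (2 * d + 4)) (≤-trans (<⇒≤ (n<2^n j)) (m≤m+n t t))

  classes = representatives {D} {m ^ (c * m)} {m} (small m N≤m)
  reps = proj₁ classes

  graphs≤ : 2 ^ (t * t) ≤ length reps * m ^ m
  graphs≤ = labelled≤representatives*relabellings (λ s → bipartite t (matrix t s)) (λ _ → id) reps
    (λ s → proj₂ (proj₂ classes) (induced (bipartite t (matrix t s)) m id) refl (universal _))
    (λ s s′ same → matrix-injective t s s′ λ i j →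
      trans (sym (adj-bipartite t _ i j)) (trans (same (i ↑ˡ t) (t ↑ʳ j)) (adj-bipartite t _ i j)))

  2jd<t : 2 * suc j * d < t
  2jd<t = <-≤-trans (subst (2 * suc j * d <_) (sym (square c N)) (m≤m+n _ _))
                    (subst (λ e → e * e ≤ 2 ^ e) (four+ c N) (n²≤2ⁿ (2 * d + N)))
    where
    square : ∀ c N → (2 * suc c + 4 + N) * (2 * suc c + 4 + N)
                   ≡ suc (2 * suc (2 * suc c + 4 + N) * suc c) + (6 * c + 21 + 4 * N + (2 * suc c + 4 + N) * N)
    square = solve-∀
    four+ : ∀ c N → 4 + (2 * suc c + N) ≡ 2 * suc c + 4 + N
    four+ = solve-∀

  exponent< : suc j * (c * m + m) < t * t
  exponent< = subst (_< t * t) (sym (e c j t)) (*-monoˡ-< t ⦃ >-nonZero (m^n>0 2 j) ⦄ 2jd<t)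
    where
    e : ∀ c j t → suc j * (c * (t + t) + (t + t)) ≡ 2 * suc j * suc c * t
    e = solve-∀

  too-few : length reps * m ^ m < 2 ^ (t * t)
  too-few = begin-strict
    length reps * m ^ m       ≤⟨ *-monoˡ-≤ (m ^ m) (proj₁ (proj₂ classes)) ⟩
    m ^ (c * m) * m ^ m       ≡⟨ ^-distribˡ-+-* m (c * m) m ⟨
    m ^ (c * m + m)           ≡⟨ cong (λ b → b ^ (c * m + m)) (cong (t +_) (sym (+-identityʳ t))) ⟩
    (2 ^ suc j) ^ (c * m + m) ≡⟨ ^-*-assoc 2 (suc j) (c * m + m) ⟩
    2 ^ (suc j * (c * m + m)) <⟨ ^-monoʳ-< 2 (s≤s (s≤s z≤n)) exponent< ⟩
    2 ^ (t * t)               ∎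
    where open ≤-Reasoning

data Return : Set where
  kA kB kC kFL kAdv kFP : Return

data State : Set where
  Start Z1 Z2 Z3 Z4 F1 F2 F3 Loop I1 I2 A1 A2 A3 A4 A5 A6 B1 B2 B3 Cc Inc Carry Adv Fa Fb FL FC Borrow Shrink FP P1 P2 Zz Halt : State
  E0 E1 E2 S0 S1 RET : Return → State

allStates : List State
allStates =
  Start ∷ Z1 ∷ Z2 ∷ Z3 ∷ Z4 ∷ F1 ∷ F2 ∷ F3 ∷ Loop ∷ I1 ∷ I2 ∷ A1 ∷ A2 ∷ A3 ∷ A4 ∷ A5 ∷ A6 ∷ B1 ∷
  B2 ∷ B3 ∷ Cc ∷ Inc ∷ Carry ∷ Adv ∷ Fa ∷ Fb ∷ FL ∷ FC ∷ Borrow ∷ Shrink ∷ FP ∷ P1 ∷ P2 ∷ Zz ∷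
  Halt ∷ E0 kA ∷ E0 kB ∷ E0 kC ∷ E0 kFL ∷ E0 kAdv ∷ E0 kFP ∷ E1 kA ∷ E1 kB ∷
  E1 kC ∷ E1 kFL ∷ E1 kAdv ∷ E1 kFP ∷ E2 kA ∷ E2 kB ∷ E2 kC ∷ E2 kFL ∷ E2 kAdv ∷
  E2 kFP ∷ S0 kA ∷ S0 kB ∷ S0 kC ∷ S0 kFL ∷ S0 kAdv ∷ S0 kFP ∷ S1 kA ∷ S1 kB ∷
  S1 kC ∷ S1 kFL ∷ S1 kAdv ∷ S1 kFP ∷ RET kA ∷ RET kB ∷ RET kC ∷ RET kFL ∷
  RET kAdv ∷ RET kFP ∷ []

#states : ℕ
#states = length allStates

encodeState : State → Fin #states
encodeState Start = # 0
encodeState Z1 = # 1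
encodeState Z2 = # 2
encodeState Z3 = # 3
encodeState Z4 = # 4
encodeState F1 = # 5
encodeState F2 = # 6
encodeState F3 = # 7
encodeState Loop = # 8
encodeState I1 = # 9
encodeState I2 = # 10
encodeState A1 = # 11
encodeState A2 = # 12
encodeState A3 = # 13
encodeState A4 = # 14
encodeState A5 = # 15
encodeState A6 = # 16
encodeState B1 = # 17
encodeState B2 = # 18
encodeState B3 = # 19
encodeState Cc = # 20
encodeState Inc = # 21
encodeState Carry = # 22
encodeState Adv = # 23
encodeState Fa = # 24
encodeState Fb = # 25
encodeState FL = # 26
encodeState FC = # 27
encodeState Borrow = # 28
encodeState Shrink = # 29
encodeState FP = # 30
encodeState P1 = # 31
encodeState P2 = # 32
encodeState Zz = # 33
encodeState Halt = # 34
encodeState (E0 kA) = # 35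
encodeState (E0 kB) = # 36
encodeState (E0 kC) = # 37
encodeState (E0 kFL) = # 38
encodeState (E0 kAdv) = # 39
encodeState (E0 kFP) = # 40
encodeState (E1 kA) = # 41
encodeState (E1 kB) = # 42
encodeState (E1 kC) = # 43
encodeState (E1 kFL) = # 44
encodeState (E1 kAdv) = # 45
encodeState (E1 kFP) = # 46
encodeState (E2 kA) = # 47
encodeState (E2 kB) = # 48
encodeState (E2 kC) = # 49
encodeState (E2 kFL) = # 50
encodeState (E2 kAdv) = # 51
encodeState (E2 kFP) = # 52
encodeState (S0 kA) = # 53
encodeState (S0 kB) = # 54
encodeState (S0 kC) = # 55
encodeState (S0 kFL) = # 56
encodeState (S0 kAdv) = # 57
encodeState (S0 kFP) = # 58
encodeState (S1 kA) = # 59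
encodeState (S1 kB) = # 60
encodeState (S1 kC) = # 61
encodeState (S1 kFL) = # 62
encodeState (S1 kAdv) = # 63
encodeState (S1 kFP) = # 64
encodeState (RET kA) = # 65
encodeState (RET kB) = # 66
encodeState (RET kC) = # 67
encodeState (RET kFL) = # 68
encodeState (RET kAdv) = # 69
encodeState (RET kFP) = # 70

decodeState : Fin #states → State
decodeState q = lookup allStates q

decodeState-encodeState : ∀ s → decodeState (encodeState s) ≡ s
decodeState-encodeState Start = refl
decodeState-encodeState Z1 = refl
decodeState-encodeState Z2 = refl
decodeState-encodeState Z3 = refl
decodeState-encodeState Z4 = refl
decodeState-encodeState F1 = refl
decodeState-encodeState F2 = refl
decodeState-encodeState F3 = refl
decodeState-encodeState Loop = refl
decodeState-encodeState I1 = refl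
decodeState-encodeState I2 = refl
decodeState-encodeState A1 = refl
decodeState-encodeState A2 = refl
decodeState-encodeState A3 = refl
decodeState-encodeState A4 = refl
decodeState-encodeState A5 = refl
decodeState-encodeState A6 = refl
decodeState-encodeState B1 = refl
decodeState-encodeState B2 = refl
decodeState-encodeState B3 = refl
decodeState-encodeState Cc = refl
decodeState-encodeState Inc = refl
decodeState-encodeState Carry = refl
decodeState-encodeState Adv = refl
decodeState-encodeState Fa = refl
decodeState-encodeState Fb = refl
decodeState-encodeState FL = refl
decodeState-encodeState FC = refl
decodeState-encodeState Borrow = refl
decodeState-encodeState Shrink = refl
decodeState-encodeState FP = refl
decodeState-encodeState P1 = refl
decodeState-encodeState P2 = refl
decodeState-encodeState Zz = refl
decodeState-encodeState Halt = refl
decodeState-encodeState (E0 kA) = refl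
decodeState-encodeState (E0 kB) = refl
decodeState-encodeState (E0 kC) = refl
decodeState-encodeState (E0 kFL) = refl
decodeState-encodeState (E0 kAdv) = refl
decodeState-encodeState (E0 kFP) = refl
decodeState-encodeState (E1 kA) = refl
decodeState-encodeState (E1 kB) = refl
decodeState-encodeState (E1 kC) = refl
decodeState-encodeState (E1 kFL) = refl
decodeState-encodeState (E1 kAdv) = refl
decodeState-encodeState (E1 kFP) = refl
decodeState-encodeState (E2 kA) = refl
decodeState-encodeState (E2 kB) = refl
decodeState-encodeState (E2 kC) = refl
decodeState-encodeState (E2 kFL) = refl
decodeState-encodeState (E2 kAdv) = refl
decodeState-encodeState (E2 kFP) = refl
decodeState-encodeState (S0 kA) = refl
decodeState-encodeState (S0 kB) = refl
decodeState-encodeState (S0 kC) = refl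
decodeState-encodeState (S0 kFL) = refl
decodeState-encodeState (S0 kAdv) = refl
decodeState-encodeState (S0 kFP) = refl
decodeState-encodeState (S1 kA) = refl
decodeState-encodeState (S1 kB) = refl
decodeState-encodeState (S1 kC) = refl
decodeState-encodeState (S1 kFL) = refl
decodeState-encodeState (S1 kAdv) = refl
decodeState-encodeState (S1 kFP) = refl
decodeState-encodeState (RET kA) = refl
decodeState-encodeState (RET kB) = refl
decodeState-encodeState (RET kC) = refl
decodeState-encodeState (RET kFL) = refl
decodeState-encodeState (RET kAdv) = refl
decodeState-encodeState (RET kFP) = refl

Symbol : Set
Symbol = Fin 4

pattern blank = fzero
pattern sym1 = fsuc fzero
pattern sym2 = fsuc (fsuc fzero)
pattern mark = fsuc (fsuc (fsuc fzero))

Action : Set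
Action = State × Symbol × Move × Move × Maybe Bool

emitting : State → Symbol → Bool → Maybe Action
emitting s w b = just (s , w , stay , stay , just b)

returnTo : Return → State
returnTo kA = A1
returnTo kB = B1
returnTo kC = Cc
returnTo kFL = FL
returnTo kAdv = Adv
returnTo kFP = FP

-- Work cell 0 holds mark; cells 1, 2, … hold the bijective base-2 digits (least significant
-- first) of a counter p, and the input head rests on input cell p.  For each p < m the
-- machine prints the gates input p and andG (2p+1 ∷ 2·parent p+1 ∷ []): the digits of 2q+1
-- are 1 followed by those of q, and dropping the lowest digit of p gives parent p.  At the
-- end of the input it prints orG over the gates 2q+2 while counting back down.  E0/E1/E2 k
-- print the counter (S0/S1 k: without its lowest digit), then RET k rewinds to the mark
-- and continues in returnTo k.
program : State → Maybe Bool → Symbol → Maybe Action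
program Start nothing w = just (Z1 , mark , stay , stay , just true)
program Start (just _) w = just (F1 , mark , stay , stay , just true)
program Z1 _ w = emitting Z2 w true
program Z2 _ w = emitting Z3 w false
program Z3 _ w = emitting Z4 w false
program Z4 _ w = emitting Halt w false
program F1 _ w = emitting F2 w true
program F2 _ w = emitting F3 w false
program F3 _ w = emitting Loop w false
program Loop nothing w = emitting Fa w true
program Loop (just _) w = emitting I1 w true
program I1 _ w = emitting I2 w false
program I2 _ w = emitting (E0 kA) w false
program A1 _ w = emitting A2 w true
program A2 _ w = emitting A3 w true
program A3 _ w = emitting A4 w false
program A4 _ w = emitting A5 w true
program A5 _ w = emitting A6 w true
program A6 _ w = emitting (E0 kB) w false
program B1 _ w = emitting B2 w true
program B2 _ w = emitting B3 w true
program B3 _ w = emitting (S0 kC) w false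
program Cc _ w = emitting Inc w false
program Inc _ w = just (Carry , w , stay , right , nothing)
program Carry _ sym1 = just (RET kAdv , sym2 , stay , left , nothing)
program Carry _ sym2 = just (Carry , sym1 , stay , right , nothing)
program Carry _ blank = just (RET kAdv , sym1 , stay , left , nothing)
program Carry _ _ = nothing
program Adv _ w = just (Loop , w , right , stay , nothing)
program Fa _ w = emitting Fb w true
program Fb _ w = emitting FL w true
program FL _ w = just (FC , w , stay , right , nothing)
program FC _ blank = emitting Zz blank false
program FC _ sym2 = just (RET kFP , sym1 , stay , left , nothing)
program FC _ sym1 = just (Borrow , sym2 , stay , right , nothing)
program FC _ _ = nothing
program Borrow _ sym2 = just (RET kFP , sym1 , stay , left , nothing)
program Borrow _ sym1 = just (Borrow , sym2 , stay , right , nothing)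
program Borrow _ blank = just (Shrink , blank , stay , left , nothing)
program Borrow _ _ = nothing
program Shrink _ w = just (RET kFP , blank , stay , left , nothing)
program FP _ w = emitting P1 w true
program P1 _ w = emitting P2 w true
program P2 _ w = emitting (E0 kFL) w true
program Zz _ w = emitting Halt w false
program Halt _ _ = nothing
program (E0 k) _ w = just (E1 k , w , stay , right , nothing)
program (E1 k) _ blank = just (RET k , blank , stay , left , just false)
program (E1 k) _ sym1 = just (E2 k , sym1 , stay , stay , just true)
program (E1 k) _ sym2 = just (E2 k , sym2 , stay , stay , just true)
program (E1 k) _ _ = nothing
program (E2 k) _ sym1 = just (E1 k , sym1 , stay , right , just false)
program (E2 k) _ sym2 = just (E1 k , sym2 , stay , right , just true)
program (E2 k) _ _ = nothing
program (S0 k) _ w = just (S1 k , w , stay , right , nothing)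
program (S1 k) _ blank = just (RET k , blank , stay , left , just false)
program (S1 k) _ sym1 = just (E1 k , sym1 , stay , right , nothing)
program (S1 k) _ sym2 = just (E1 k , sym2 , stay , right , nothing)
program (S1 k) _ _ = nothing
program (RET k) _ mark = just (returnTo k , mark , stay , stay , nothing)
program (RET k) _ w = just (RET k , w , stay , left , nothing)

encodeAction : Maybe Action → Maybe (Fin #states × Fin 4 × Move × Move × Maybe Bool)
encodeAction nothing = nothing
encodeAction (just (s , w , a , b , o)) = just (encodeState s , w , a , b , o)

printer : TM
printer = record { Q = #states ; Γ = 3 ; start = encodeState Start ; δ = λ q i w → encodeAction (program (decodeState q) i w) }

Cfg : Set
Cfg = Config printer

tapeAt : (ℕ → Symbol) → ℕ → Symbol
tapeAt T zero = mark
tapeAt T (suc i) = T i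

writeTape : (ℕ → Symbol) → ℕ → Symbol → ℕ → Symbol
writeTape T zero a = T
writeTape T (suc j) a i = if i ≡ᵇ j then a else T i

emit : List Bool → Maybe Bool → List Bool
emit o nothing = o
emit o (just b) = o ++ b ∷ []

-- T i is the content of work cell 1 + i.
record Matches (c : Cfg) (s : State) (ip wp : ℕ) (T : ℕ → Symbol) (o : List Bool) : Set where
  constructor mkMatches
  field
    state≡ : Config.state c ≡ encodeState s
    ipos≡ : Config.ipos c ≡ ip
    wpos≡ : Config.wpos c ≡ wp
    marked : Config.work c 0 ≡ mark
    tape≡ : ∀ i → Config.work c (suc i) ≡ T i
    out≡ : Config.out c ≡ o

Matches-cong : ∀ {c s ip ip' wp wp' T T' o o'} → Matches c s ip wp T o → ip ≡ ip' → wp ≡ wp' → (∀ i → T i ≡ T' i) → o ≡ o' →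
  Matches c s ip' wp' T' o'
Matches-cong (mkMatches s≡ i≡ w≡ marked T≡ o≡) refl refl T≡T′ refl = mkMatches s≡ i≡ w≡ marked (λ i → trans (T≡ i) (T≡T′ i)) o≡

Matches-cell : ∀ {c s ip wp T o} → Matches c s ip wp T o → Config.work c (Config.wpos c) ≡ tapeAt T wp
Matches-cell {wp = zero} (mkMatches _ _ refl marked _ _) = marked
Matches-cell {wp = suc j} (mkMatches _ _ refl _ tape≡ _) = tape≡ j

mark-kept : ∀ wp cw (a w : Symbol) → cw ≡ wp → (wp ≡ 0 → a ≡ mark) → w ≡ mark → (if 0 ≡ᵇ cw then a else w) ≡ mark
mark-kept zero .zero a w refl a≡mark _ = a≡mark refl
mark-kept (suc j) .(suc j) a w refl _ w≡mark = w≡mark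

writeTape-correct : ∀ wp cw (a : Symbol) T (W : ℕ → Symbol) → cw ≡ wp → (∀ i → W (suc i) ≡ T i) →
  ∀ i → (if suc i ≡ᵇ cw then a else W (suc i)) ≡ writeTape T wp a i
writeTape-correct zero .zero a T W refl W≡T i = W≡T i
writeTape-correct (suc j) .(suc j) a T W refl W≡T i with i ≡ᵇ j
... | true = refl
... | false = W≡T i

step-Matches : ∀ x {c s ip wp T o s' a mi mw ob} → Matches c s ip wp T o →
  program s (readInput x ip) (tapeAt T wp) ≡ just (s' , a , mi , mw , ob) → (wp ≡ 0 → a ≡ mark) →
  Matches (step printer x c) s' (move mi ip ⊓ length x) (move mw wp) (writeTape T wp a) (emit o ob)
step-Matches x {c} {s} {ip} {wp} {T} {o} {s'} {a} {mi} {mw} {ob} m program≡ a≢mark = after-δ ob δ≡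
  where
  open Matches m
  δ≡ : TM.δ printer (Config.state c) (readInput x (Config.ipos c)) (Config.work c (Config.wpos c))
       ≡ just (encodeState s' , a , mi , mw , ob)
  δ≡ rewrite state≡ | ipos≡ | Matches-cell m | decodeState-encodeState s | program≡ = refl
  after-δ : ∀ ob → TM.δ printer (Config.state c) (readInput x (Config.ipos c)) (Config.work c (Config.wpos c))
              ≡ just (encodeState s' , a , mi , mw , ob) →
    Matches (step printer x c) s' (move mi ip ⊓ length x) (move mw wp) (writeTape T wp a) (emit o ob)
  after-δ ob δ≡ with TM.δ printer (Config.state c) (readInput x (Config.ipos c)) (Config.work c (Config.wpos c))
  after-δ nothing refl | just _ =
    mkMatches refl (cong (λ i → move mi i ⊓ length x) ipos≡) (cong (move mw) wpos≡)
      (mark-kept wp _ a _ wpos≡ a≢mark marked) (writeTape-correct wp _ a T (Config.work c) wpos≡ tape≡) out≡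
  after-δ (just b) refl | just _ =
    mkMatches refl (cong (λ i → move mi i ⊓ length x) ipos≡) (cong (move mw) wpos≡)
      (mark-kept wp _ a _ wpos≡ a≢mark marked) (writeTape-correct wp _ a T (Config.work c) wpos≡ tape≡) (cong (_++ b ∷ []) out≡)

data Digit : Set where
  D1 D2 : Digit

digitSymbol : Digit → Symbol
digitSymbol D1 = sym1
digitSymbol D2 = sym2

digitBit : Digit → Bool
digitBit D1 = false
digitBit D2 = true

digitTape : List Digit → ℕ → Symbol
digitTape [] i = blank
digitTape (d ∷ ds) zero = digitSymbol d
digitTape (d ∷ ds) (suc i) = digitTape ds i

encDigits : List Digit → List Bool
encDigits [] = []
encDigits (d ∷ ds) = true ∷ digitBit d ∷ encDigits ds

dropDigit : List Digit → List Digit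
dropDigit [] = []
dropDigit (d ∷ r) = r

incDigits : List Digit → List Digit
incDigits [] = D1 ∷ []
incDigits (D1 ∷ r) = D2 ∷ r
incDigits (D2 ∷ r) = D1 ∷ incDigits r

decDigits : List Digit → List Digit
decDigits [] = []
decDigits (D2 ∷ r) = D1 ∷ r
decDigits (D1 ∷ []) = []
decDigits (D1 ∷ d ∷ r) = D2 ∷ decDigits (d ∷ r)

digits : ℕᵇ → List Digit
digits zeroᵇ = []
digits 2[1+ b ] = D2 ∷ digits b
digits 1+[2 b ] = D1 ∷ digits b

digitsℕ : ℕ → List Digit
digitsℕ p = digits (fromℕ' p)

inc-digits : ∀ b → digits (sucᵇ b) ≡ incDigits (digits b)
inc-digits zeroᵇ = refl
inc-digits 2[1+ b ] = cong (D1 ∷_) (inc-digits b)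
inc-digits 1+[2 b ] = refl

digits-suc≢[] : ∀ b → digits (sucᵇ b) ≢ []
digits-suc≢[] zeroᵇ ()
digits-suc≢[] 2[1+ b ] ()
digits-suc≢[] 1+[2 b ] ()

dec-digits : ∀ b → decDigits (digits (sucᵇ b)) ≡ digits b
dec-digits zeroᵇ = refl
dec-digits 1+[2 b ] = refl
dec-digits 2[1+ b ] with digits (sucᵇ b) | dec-digits b | digits-suc≢[] b
... | [] | _ | ne = ⊥-elim (ne refl)
... | d ∷ r | ih | _ = cong (D2 ∷_) ih

encBin≡encDigits : ∀ b → encBin b ≡ encDigits (digits b) ++ false ∷ []
encBin≡encDigits zeroᵇ = refl
encBin≡encDigits 2[1+ b ] = cong (λ z → true ∷ true ∷ z) (encBin≡encDigits b)
encBin≡encDigits 1+[2 b ] = cong (λ z → true ∷ false ∷ z) (encBin≡encDigits b)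

encℕ≡encDigits : ∀ p → encℕ p ≡ encDigits (digitsℕ p) ++ false ∷ []
encℕ≡encDigits p = trans (cong encBin (fromℕ≡fromℕ' p)) (encBin≡encDigits (fromℕ' p))

incDigits-digitsℕ : ∀ p → incDigits (digitsℕ p) ≡ digitsℕ (suc p)
incDigits-digitsℕ p = sym (inc-digits (fromℕ' p))

decDigits-digitsℕ : ∀ q → decDigits (digitsℕ (suc q)) ≡ digitsℕ q
decDigits-digitsℕ q = dec-digits (fromℕ' q)

digitsℕ-suc≢[] : ∀ q → digitsℕ (suc q) ≢ []
digitsℕ-suc≢[] q = digits-suc≢[] (fromℕ' q)

fromℕ'-suc : ∀ q → (fromℕ' (suc q) ≡ 1+[2 fromℕ' ⌊ q /2⌋ ]) ⊎ (fromℕ' (suc q) ≡ 2[1+ fromℕ' ⌊ q /2⌋ ])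
fromℕ'-suc zero = inj₁ refl
fromℕ'-suc (suc zero) = inj₂ refl
fromℕ'-suc (suc (suc q)) with fromℕ'-suc q
... | inj₁ e = inj₁ (cong (λ z → sucᵇ (sucᵇ z)) e)
... | inj₂ e = inj₂ (cong (λ z → sucᵇ (sucᵇ z)) e)

dropDigit-digitsℕ : ∀ p → dropDigit (digitsℕ p) ≡ digitsℕ (parent p)
dropDigit-digitsℕ zero = refl
dropDigit-digitsℕ (suc q) with fromℕ'-suc q
... | inj₁ e = cong (λ z → dropDigit (digits z)) e
... | inj₂ e = cong (λ z → dropDigit (digits z)) e

fromℕ'-odd : ∀ p → fromℕ' (suc (2 * p)) ≡ 1+[2 fromℕ' p ]
fromℕ'-odd zero = refl
fromℕ'-odd (suc p) = trans (cong (λ z → fromℕ' (suc z)) (*-suc 2 p)) (cong (λ z → sucᵇ (sucᵇ z)) (fromℕ'-odd p))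

fromℕ'-even : ∀ q → fromℕ' (suc (suc (2 * q))) ≡ 2[1+ fromℕ' q ]
fromℕ'-even q = cong sucᵇ (fromℕ'-odd q)

encℕ-odd : ∀ p → encℕ (suc (2 * p)) ≡ true ∷ false ∷ encℕ p
encℕ-odd p = trans (cong encBin (trans (fromℕ≡fromℕ' (suc (2 * p))) (fromℕ'-odd p))) (cong (λ z → true ∷ false ∷ encBin z) (sym (fromℕ≡fromℕ' p)))

encℕ-even : ∀ q → encℕ (suc (suc (2 * q))) ≡ true ∷ true ∷ encℕ q
encℕ-even q = trans (cong encBin (trans (fromℕ≡fromℕ' (suc (suc (2 * q)))) (fromℕ'-even q))) (cong (λ z → true ∷ true ∷ encBin z) (sym (fromℕ≡fromℕ' q)))

2^length-digits≤ : ∀ b → 2 ^ length (digits b) ≤ suc (toℕᵇ b)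
2^length-digits≤ zeroᵇ = ≤-refl
2^length-digits≤ 2[1+ b ] = ≤-trans (*-monoʳ-≤ 2 (2^length-digits≤ b)) (n≤1+n _)
2^length-digits≤ 1+[2 b ] = ≤-trans (*-monoʳ-≤ 2 (2^length-digits≤ b)) (≤-reflexive (*-suc 2 (toℕᵇ b)))

length-digitsℕ≤ : ∀ p m → p ≤ m → length (digitsℕ p) ≤ suc ⌈log₂ m ⌉
length-digitsℕ≤ p m p≤m with length (digitsℕ p) in eqL
... | zero = z≤n
... | suc L = s≤s (subst (_≤ ⌈log₂ m ⌉) (⌈log₂2^n⌉≡n L) (⌈log₂⌉-mono-≤ (≤-trans h p≤m)))
  where
  h0 : 2 ^ suc L ≤ suc p
  h0 = subst (λ z → 2 ^ z ≤ suc p) eqL (subst (λ z → 2 ^ length (digitsℕ p) ≤ suc z) (toℕ-fromℕ' p) (2^length-digits≤ (fromℕ' p)))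
  h : 2 ^ L ≤ p
  h = ≤-pred (begin
      suc (2 ^ L)         ≡⟨ +-comm 1 (2 ^ L) ⟩
      2 ^ L + 1           ≤⟨ +-monoʳ-≤ (2 ^ L) (m^n>0 2 L) ⟩
      2 ^ L + 2 ^ L       ≡⟨ cong (2 ^ L +_) (sym (+-identityʳ _)) ⟩
      2 ^ L + (2 ^ L + 0) ≤⟨ h0 ⟩
      suc p               ∎)
    where open ≤-Reasoning

Unmarked : (ℕ → Symbol) → Set
Unmarked T = ∀ i → T i ≢ mark

digitTape-unmarked : ∀ ds → Unmarked (digitTape ds)
digitTape-unmarked [] i ()
digitTape-unmarked (D1 ∷ ds) zero ()
digitTape-unmarked (D2 ∷ ds) zero ()
digitTape-unmarked (d ∷ ds) (suc i) e = digitTape-unmarked ds i e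

program-RET : ∀ k i w → w ≢ mark → program (RET k) i w ≡ just (RET k , w , stay , left , nothing)
program-RET k i blank _ = refl
program-RET k i sym1 _ = refl
program-RET k i sym2 _ = refl
program-RET k i mark h = ⊥-elim (h refl)

writeTape-same : ∀ T j {a} → T j ≡ a → ∀ i → writeTape T (suc j) a i ≡ T i
writeTape-same T j Tj i with i ≡ᵇ j in eq
... | true = trans (sym Tj) (cong T (sym (≡ᵇ-true i j eq)))
... | false = refl

program-E1 : ∀ k i d → program (E1 k) i (digitSymbol d) ≡ just (E2 k , digitSymbol d , stay , stay , just true)
program-E1 k i D1 = refl
program-E1 k i D2 = refl

program-E2 : ∀ k i d → program (E2 k) i (digitSymbol d) ≡ just (E1 k , digitSymbol d , stay , right , just (digitBit d))
program-E2 k i D1 = refl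
program-E2 k i D2 = refl

program-S1 : ∀ k i d → program (S1 k) i (digitSymbol d) ≡ just (E1 k , digitSymbol d , stay , right , nothing)
program-S1 k i D1 = refl
program-S1 k i D2 = refl

writeTape-cong : ∀ w a {T T'} → (∀ j → T j ≡ T' j) → ∀ i → writeTape T w a i ≡ writeTape T' w a i
writeTape-cong zero a T≗T′ i = T≗T′ i
writeTape-cong (suc w) a T≗T′ i with i ≡ᵇ w
... | true = refl
... | false = T≗T′ i

digitTape-at : ∀ pre r → digitTape (pre ++ r) (length pre) ≡ digitTape r 0
digitTape-at [] r = refl
digitTape-at (p ∷ pre) r = digitTape-at pre r

writeTape-digit : ∀ pre d r d' i → writeTape (digitTape (pre ++ d ∷ r)) (suc (length pre)) (digitSymbol d') i ≡ digitTape (pre ++ d' ∷ r) i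
writeTape-digit [] d r d' zero = refl
writeTape-digit [] d r d' (suc i) = refl
writeTape-digit (p ∷ pre) d r d' zero = refl
writeTape-digit (p ∷ pre) d r d' (suc i) = writeTape-digit pre d r d' i

writeTape-append : ∀ pre d' i → writeTape (digitTape (pre ++ [])) (suc (length pre)) (digitSymbol d') i ≡ digitTape (pre ++ d' ∷ []) i
writeTape-append [] d' zero = refl
writeTape-append [] d' (suc i) = refl
writeTape-append (p ∷ pre) d' zero = refl
writeTape-append (p ∷ pre) d' (suc i) = writeTape-append pre d' i

writeTape-erase : ∀ pre d i → writeTape (digitTape (pre ++ d ∷ [])) (suc (length pre)) blank i ≡ digitTape (pre ++ []) i
writeTape-erase [] d zero = refl
writeTape-erase [] d (suc i) = refl
writeTape-erase (p ∷ pre) d zero = refl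
writeTape-erase (p ∷ pre) d (suc i) = writeTape-erase pre d i

++-assoc₃ : ∀ {A : Set} (o : List A) a b r → ((o ++ a ∷ []) ++ b ∷ []) ++ r ≡ o ++ (a ∷ b ∷ r)
++-assoc₃ o a b r = trans (++-assoc (o ++ a ∷ []) (b ∷ []) r) (++-assoc o (a ∷ []) (b ∷ r))

length-snoc : ∀ {A : Set} (xs : List A) (a : A) → length (xs ++ a ∷ []) ≡ suc (length xs)
length-snoc xs a = trans (length-++ xs) (+-comm (length xs) 1)

length-swap : ∀ {A : Set} (pre : List A) a b r → length (pre ++ a ∷ r) ≡ length (pre ++ b ∷ r)
length-swap pre a b r = trans (length-++-sucʳ pre a r) (sym (length-++-sucʳ pre b r))

length-<-++∷ : ∀ {A : Set} (pre : List A) d r → suc (length pre) ≤ length (pre ++ d ∷ r)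
length-<-++∷ pre d r = ≤-trans (s≤s (length-++-≤ˡ pre)) (≤-reflexive (sym (length-++-sucʳ pre d r)))

length-++∷≢0 : ∀ {A B : Set} (pre : List A) d → length (pre ++ d ∷ []) ≡ 0 → B
length-++∷≢0 [] d ()
length-++∷≢0 (p ∷ pre) d ()

ComputesInSpace-weaken : ∀ {M x y s s′} → s ≤ s′ → ComputesInSpace M x y s → ComputesInSpace M x y s′
ComputesInSpace-weaken s≤s′ (halts , within) = halts , λ t → ≤-trans (within t) s≤s′

module Run (x : List Bool) (B : ℕ) where

  steps : ℕ → Cfg → Cfg
  steps zero c = c
  steps (suc k) c = step printer x (steps k c)

  steps-+ : ∀ a b c → steps (a + b) c ≡ steps a (steps b c)
  steps-+ zero b c = refl
  steps-+ (suc a) b c = cong (step printer x) (steps-+ a b c)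

  run≡steps : ∀ t → run printer x t ≡ steps t (initConfig printer)
  run≡steps zero = refl
  run≡steps (suc t) = cong (step printer x) (run≡steps t)

  record Phase (c : Cfg) (P : Cfg → Set) : Set where
    constructor mkPhase
    field
      k : ℕ
      post : P (steps k c)
      bounded : ∀ j → j ≤ k → Config.wpos (steps j c) ≤ B

  infixr 1 _then_
  _then_ : ∀ {c P Q} → Phase c P → (∀ {c'} → P c' → Phase c' Q) → Phase c Q
  _then_ {c} {P} {Q} (mkPhase k1 p1 b1) f with f p1
  ... | mkPhase k2 p2 b2 = mkPhase (k2 + k1) (subst Q (sym (steps-+ k2 k1 c)) p2) bounded
    where
    bounded : ∀ j → j ≤ k2 + k1 → Config.wpos (steps j c) ≤ B
    bounded j j≤ with j ≤? k1
    ... | yes j≤k1 = b1 j j≤k1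
    ... | no j≰k1 = subst (λ z → Config.wpos z ≤ B) (sym eqj) (b2 (j ∸ k1) (≤-trans (∸-monoˡ-≤ k1 j≤) (≤-reflexive (m+n∸n≡m k2 k1))))
      where
      eqj : steps j c ≡ steps (j ∸ k1) (steps k1 c)
      eqj = trans (cong (λ z → steps z c) (sym (m∸n+n≡m (≰⇒≥ j≰k1)))) (steps-+ (j ∸ k1) k1 c)

  firstStep : ∀ {P : Cfg → Set} → P (steps 1 (initConfig printer)) → Config.wpos (steps 1 (initConfig printer)) ≤ B →
    Phase (initConfig printer) P
  firstStep p b = mkPhase 1 p λ { zero _ → z≤n ; (suc zero) _ → b ; (suc (suc j)) (s≤s ()) }

  done : ∀ {c} {P : Cfg → Set} → P c → Config.wpos c ≤ B → Phase c P
  done p b = mkPhase 0 p (λ { zero _ → b })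

  stepPhase : ∀ {c s ip wp T o s' a mi mw ob ip' wp' T' o'} → Matches c s ip wp T o → wp ≤ B →
    program s (readInput x ip) (tapeAt T wp) ≡ just (s' , a , mi , mw , ob) → (wp ≡ 0 → a ≡ mark) →
    move mi ip ⊓ length x ≡ ip' → move mw wp ≡ wp' → (∀ i → writeTape T wp a i ≡ T' i) → emit o ob ≡ o' → wp' ≤ B →
    Phase c (λ c' → Matches c' s' ip' wp' T' o')
  stepPhase {c} m wb eδ w0 e1 e2 e3 e4 wb' = mkPhase 1 (Matches-cong (step-Matches x m eδ w0) e1 e2 e3 e4) bounded
    where
    bounded : ∀ j → j ≤ 1 → Config.wpos (steps j c) ≤ B
    bounded zero _ = subst (_≤ B) (sym (Matches.wpos≡ m)) wb
    bounded (suc zero) _ = subst (_≤ B) (sym (trans (Matches.wpos≡ (step-Matches x m eδ w0)) e2)) wb'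
    bounded (suc (suc j)) (s≤s ())

  stepPhaseOn : ∀ {c s ip wp T o w s' a mi mw ob ip' wp' T' o'} → Matches c s ip wp T o → wp ≤ B →
    tapeAt T wp ≡ w → program s (readInput x ip) w ≡ just (s' , a , mi , mw , ob) → (wp ≡ 0 → a ≡ mark) →
    move mi ip ⊓ length x ≡ ip' → move mw wp ≡ wp' → (∀ i → writeTape T wp a i ≡ T' i) → emit o ob ≡ o' → wp' ≤ B →
    Phase c (λ c' → Matches c' s' ip' wp' T' o')
  stepPhaseOn m wb refl = stepPhase m wb

  stay-within : ∀ {ip} → ip ≤ length x → move stay ip ⊓ length x ≡ ip
  stay-within le = m≤n⇒m⊓n≡m le

  rewind : ∀ k ip T → ip ≤ length x → Unmarked T → ∀ j {c o} → Matches c (RET k) ip j T o → j ≤ B →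
    Phase c (λ c' → Matches c' (returnTo k) ip 0 T o)
  rewind k ip T ipx nm zero m jb = stepPhase m jb refl (λ _ → refl) (stay-within ipx) refl (λ i → refl) refl jb
  rewind k ip T ipx nm (suc j) m jb =
    stepPhase m jb (program-RET k _ (T j) (nm j)) (λ ()) (stay-within ipx) refl (writeTape-same T j refl) refl (≤-trans (n≤1+n j) jb) then λ m' →
    rewind k ip T ipx nm j m' (≤-trans (n≤1+n j) jb)

  printDigits : ∀ k ip T → ip ≤ length x → Unmarked T → ∀ rest i {c o} → Matches c (E1 k) ip (suc i) T o →
    (∀ j → T (i + j) ≡ digitTape rest j) → suc (i + length rest) ≤ B →
    Phase c (λ c' → Matches c' (RET k) ip (i + length rest) T (o ++ encDigits rest ++ false ∷ []))
  printDigits k ip T ipx nm [] i m h b = stepPhaseOn m b0 Ti refl (λ ())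
      (stay-within ipx) (sym (+-identityʳ i)) (writeTape-same T i Ti) refl (≤-trans (n≤1+n (i + 0)) b)
    where
    Ti : T i ≡ blank
    Ti = trans (cong T (sym (+-identityʳ i))) (h 0)
    b0 : suc i ≤ B
    b0 = subst (λ z → suc z ≤ B) (+-identityʳ i) b
  printDigits k ip T ipx nm (d ∷ r) i {o = o} m h b =
    stepPhaseOn m b1 Ti (program-E1 k _ d) (λ ())
          (stay-within ipx) refl (writeTape-same T i Ti) refl b1 then λ m1 →
    stepPhaseOn m1 b1 Ti (program-E2 k _ d) (λ ())
          (stay-within ipx) refl (writeTape-same T i Ti) refl b2 then λ {c2} m2 →
    subst (λ z → Phase c2 (λ c' → Matches c' (RET k) ip z T (o ++ encDigits (d ∷ r) ++ false ∷ []))) (sym (+-suc i (length r)))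
      (subst (λ z → Phase c2 (λ c' → Matches c' (RET k) ip (suc i + length r) T z)) (++-assoc₃ o true (digitBit d) (encDigits r ++ false ∷ []))
        (printDigits k ip T ipx nm r (suc i) m2 (λ j → trans (cong T (sym (+-suc i j))) (h (suc j))) (≤-trans (≤-reflexive (cong suc (sym (+-suc i (length r))))) b)))
    where
    Ti : T i ≡ digitSymbol d
    Ti = trans (cong T (sym (+-identityʳ i))) (h 0)
    b1 : suc i ≤ B
    b1 = ≤-trans (s≤s (m≤m+n i _)) b
    b2 : suc (suc i) ≤ B
    b2 = ≤-trans (s≤s (≤-trans (s≤s (m≤m+n i (length r))) (≤-reflexive (sym (+-suc i (length r)))))) b

  printCounter : ∀ k ip ds {c o} → ip ≤ length x → Matches c (E0 k) ip 0 (digitTape ds) o → suc (length ds) ≤ B →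
    Phase c (λ c' → Matches c' (returnTo k) ip 0 (digitTape ds) (o ++ encDigits ds ++ false ∷ []))
  printCounter k ip ds ipx m b =
    stepPhase m z≤n refl (λ _ → refl) (stay-within ipx) refl (λ i → refl) refl (≤-trans (s≤s z≤n) b) then λ m1 →
    printDigits k ip (digitTape ds) ipx (digitTape-unmarked ds) ds 0 m1 (λ j → refl) b then λ m2 →
    rewind k ip (digitTape ds) ipx (digitTape-unmarked ds) (length ds) m2 (≤-trans (n≤1+n _) b)

  printParent : ∀ k ip ds {c o} → ip ≤ length x → Matches c (S0 k) ip 0 (digitTape ds) o → suc (length ds) ≤ B →
    Phase c (λ c' → Matches c' (returnTo k) ip 0 (digitTape ds) (o ++ encDigits (dropDigit ds) ++ false ∷ []))
  printParent k ip [] ipx m b =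
    stepPhase m z≤n refl (λ _ → refl) (stay-within ipx) refl (λ i → refl) refl b then λ m1 →
    stepPhase m1 b refl (λ ()) (stay-within ipx) refl (writeTape-same (digitTape []) 0 refl) refl z≤n then λ m2 →
    rewind k ip (digitTape []) ipx (digitTape-unmarked []) 0 m2 z≤n
  printParent k ip (d ∷ r) ipx m b =
    stepPhase m z≤n refl (λ _ → refl) (stay-within ipx) refl (λ i → refl) refl (≤-trans (s≤s z≤n) b) then λ m1 →
    stepPhase m1 (≤-trans (s≤s z≤n) b) (program-S1 k _ d) (λ ()) (stay-within ipx) refl (writeTape-same (digitTape (d ∷ r)) 0 refl) refl (≤-trans (s≤s (s≤s z≤n)) b) then λ m2 →
    printDigits k ip (digitTape (d ∷ r)) ipx (digitTape-unmarked (d ∷ r)) r 1 m2 (λ j → refl) b then λ m3 →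
    rewind k ip (digitTape (d ∷ r)) ipx (digitTape-unmarked (d ∷ r)) (suc (length r)) m3 (≤-trans (n≤1+n _) b)

  mapPhase : ∀ {c} {P Q : Cfg → Set} → Phase c P → (∀ {c'} → P c' → Q c') → Phase c Q
  mapPhase (mkPhase k p b) f = mkPhase k (f p) b

  increment : ∀ ip → ip ≤ length x → ∀ pre ds {c o} → Matches c Carry ip (suc (length pre)) (digitTape (pre ++ ds)) o → suc (length (pre ++ ds)) ≤ B →
    Phase c (λ c' → Matches c' Adv ip 0 (digitTape (pre ++ incDigits ds)) o)
  increment ip ipx pre [] m b =
    stepPhaseOn m b1 (digitTape-at pre []) refl (λ ())
           (stay-within ipx) refl (writeTape-append pre D1) refl (≤-trans (n≤1+n _) b1) then λ m1 →
    rewind kAdv ip (digitTape (pre ++ D1 ∷ [])) ipx (digitTape-unmarked (pre ++ D1 ∷ [])) (length pre) m1 (≤-trans (n≤1+n _) b1)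
    where
    b1 : suc (length pre) ≤ B
    b1 = subst (λ z → suc (length z) ≤ B) (++-identityʳ pre) b
  increment ip ipx pre (D1 ∷ r) m b =
    stepPhaseOn m b1 (digitTape-at pre (D1 ∷ r)) refl (λ ())
           (stay-within ipx) refl (writeTape-digit pre D1 r D2) refl (≤-trans (n≤1+n _) b1) then λ m1 →
    rewind kAdv ip (digitTape (pre ++ D2 ∷ r)) ipx (digitTape-unmarked (pre ++ D2 ∷ r)) (length pre) m1 (≤-trans (n≤1+n _) b1)
    where
    b1 : suc (length pre) ≤ B
    b1 = ≤-trans (s≤s (≤-trans (m≤m+n (length pre) (length (D1 ∷ r))) (≤-reflexive (sym (length-++ pre))))) b
  increment ip ipx pre (D2 ∷ r) m b =
    stepPhaseOn m b1 (digitTape-at pre (D2 ∷ r)) refl (λ ())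
           (stay-within ipx) (cong suc (sym (length-snoc pre D1))) (λ i → trans (writeTape-digit pre D2 r D1 i) (cong (λ z → digitTape z i) (sym (++-assoc pre (D1 ∷ []) r)))) refl (subst (λ z → suc z ≤ B) (sym (length-snoc pre D1)) b2) then λ m1 →
    mapPhase (increment ip ipx (pre ++ D1 ∷ []) r m1 (subst (λ z → suc z ≤ B) (trans (length-swap pre D2 D1 r) (cong length (sym (++-assoc pre (D1 ∷ []) r)))) b))
      (λ m2 → Matches-cong m2 refl refl (λ i → cong (λ z → digitTape z i) (++-assoc pre (D1 ∷ []) (incDigits r))) refl)
    where
    b1 : suc (length pre) ≤ B
    b1 = ≤-trans (s≤s (≤-trans (m≤m+n (length pre) (length (D2 ∷ r))) (≤-reflexive (sym (length-++ pre))))) b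
    b2 : suc (suc (length pre)) ≤ B
    b2 = ≤-trans (s≤s (≤-trans (≤-trans (≤-reflexive (+-comm 1 (length pre))) (+-monoʳ-≤ (length pre) (s≤s z≤n))) (≤-reflexive (sym (length-++ pre))))) b

  decrementBorrow : ∀ ip → ip ≤ length x → ∀ pre0 ds {c o} → Matches c Borrow ip (suc (length (pre0 ++ D2 ∷ []))) (digitTape ((pre0 ++ D2 ∷ []) ++ ds)) o →
    suc (length ((pre0 ++ D2 ∷ []) ++ ds)) ≤ B →
    Phase c (λ c' → Matches c' FP ip 0 (digitTape (pre0 ++ decDigits (D1 ∷ ds))) o)
  decrementBorrow ip ipx pre0 [] m b =
    stepPhaseOn m b0 cur refl (λ ())
           (stay-within ipx) refl (writeTape-same _ _ cur) refl b1 then λ m1 →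
    stepPhase m1 b1 refl (length-++∷≢0 pre0 D2) (stay-within ipx) (cong (_∸ 1) (length-snoc pre0 D2)) upd refl (≤-trans (n≤1+n _) b1') then λ m2 →
    rewind kFP ip (digitTape (pre0 ++ [])) ipx (digitTape-unmarked (pre0 ++ [])) (length pre0) m2 (≤-trans (n≤1+n _) b1')
    where
    Pd = pre0 ++ D2 ∷ []
    b0 : suc (length Pd) ≤ B
    b0 = subst (λ z → suc (length z) ≤ B) (++-identityʳ Pd) b
    cur : digitTape (Pd ++ []) (length Pd) ≡ blank
    cur = digitTape-at Pd []
    b1 : length Pd ≤ B
    b1 = ≤-trans (≤-trans (length-++-≤ˡ Pd {[]}) (n≤1+n _)) b
    b1' : suc (length pre0) ≤ B
    b1' = subst (_≤ B) (length-snoc pre0 D2) b1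
    upd : ∀ i → writeTape (digitTape (Pd ++ [])) (length Pd) blank i ≡ digitTape (pre0 ++ []) i
    upd i = trans (cong (λ z → writeTape (digitTape (Pd ++ [])) z blank i) (length-snoc pre0 D2))
             (trans (writeTape-cong (suc (length pre0)) blank (λ j → cong (λ z → digitTape z j) (++-identityʳ Pd)) i)
               (writeTape-erase pre0 D2 i))
  decrementBorrow ip ipx pre0 (D2 ∷ r) m b =
    stepPhaseOn m (≤-trans (s≤s (length-++-≤ˡ (pre0 ++ D2 ∷ []) {D2 ∷ r})) b) (digitTape-at (pre0 ++ D2 ∷ []) (D2 ∷ r)) refl (λ ())
           (stay-within ipx) refl (λ i → trans (writeTape-digit (pre0 ++ D2 ∷ []) D2 r D1 i) (cong (λ z → digitTape z i) (++-assoc pre0 (D2 ∷ []) (D1 ∷ r)))) refl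
           (≤-trans (length-++-≤ˡ (pre0 ++ D2 ∷ []) {D2 ∷ r}) (≤-trans (n≤1+n _) b)) then λ m1 →
    rewind kFP ip (digitTape (pre0 ++ D2 ∷ D1 ∷ r)) ipx (digitTape-unmarked (pre0 ++ D2 ∷ D1 ∷ r)) _ m1 (≤-trans (length-++-≤ˡ (pre0 ++ D2 ∷ []) {D2 ∷ r}) (≤-trans (n≤1+n _) b))
  decrementBorrow ip ipx pre0 (D1 ∷ r) m b =
    stepPhaseOn m b0 (digitTape-at (pre0 ++ D2 ∷ []) (D1 ∷ r)) refl (λ ())
           (stay-within ipx) (cong suc (sym (length-snoc (pre0 ++ D2 ∷ []) D2)))
           (λ i → trans (writeTape-digit (pre0 ++ D2 ∷ []) D1 r D2 i) (cong (λ z → digitTape z i) (sym (++-assoc (pre0 ++ D2 ∷ []) (D2 ∷ []) r)))) refl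
           (subst (λ z → suc z ≤ B) (sym (length-snoc (pre0 ++ D2 ∷ []) D2)) b1) then λ m1 →
    mapPhase (decrementBorrow ip ipx (pre0 ++ D2 ∷ []) r m1 (subst (λ z → suc z ≤ B) (trans (length-swap (pre0 ++ D2 ∷ []) D1 D2 r) (cong length (sym (++-assoc (pre0 ++ D2 ∷ []) (D2 ∷ []) r)))) b))
      (λ m2 → Matches-cong m2 refl refl (λ i → cong (λ z → digitTape z i) (++-assoc pre0 (D2 ∷ []) (decDigits (D1 ∷ r)))) refl)
    where
    b0 : suc (length (pre0 ++ D2 ∷ [])) ≤ B
    b0 = ≤-trans (s≤s (length-++-≤ˡ (pre0 ++ D2 ∷ []) {D1 ∷ r})) b
    b1 : suc (suc (length (pre0 ++ D2 ∷ []))) ≤ B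
    b1 = ≤-trans (s≤s (length-<-++∷ (pre0 ++ D2 ∷ []) D1 r)) b

  decrement : ∀ ip → ip ≤ length x → ∀ ds {c o} → Matches c FC ip 1 (digitTape ds) o → ds ≢ [] → suc (length ds) ≤ B →
    Phase c (λ c' → Matches c' FP ip 0 (digitTape (decDigits ds)) o)
  decrement ip ipx [] m ne b = ⊥-elim (ne refl)
  decrement ip ipx (D2 ∷ r) m ne b =
    stepPhase m (≤-trans (s≤s z≤n) b) refl (λ ()) (stay-within ipx) refl (writeTape-digit [] D2 r D1) refl z≤n then λ m1 →
    rewind kFP ip (digitTape (D1 ∷ r)) ipx (digitTape-unmarked (D1 ∷ r)) 0 m1 z≤n
  decrement ip ipx (D1 ∷ r) m ne b =
    stepPhase m (≤-trans (s≤s z≤n) b) refl (λ ()) (stay-within ipx) refl (writeTape-digit [] D1 r D2) refl (≤-trans (s≤s (s≤s z≤n)) b) then λ m1 →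
    decrementBorrow ip ipx [] r m1 b

  printBit : ∀ {c s s' ip T o L b} → ip ≤ length x → Matches c s ip 0 T (o ++ L) →
    program s (readInput x ip) mark ≡ just (s' , mark , stay , stay , just b) →
    Phase c (λ c' → Matches c' s' ip 0 T (o ++ (L ++ b ∷ [])))
  printBit {o = o} {L} {b} ipx m eδ = stepPhase m z≤n eδ (λ _ → refl) (stay-within ipx) refl (λ i → refl) (++-assoc o L (b ∷ [])) z≤n

  step-halted : ∀ c → halted printer x c → step printer x c ≡ c
  step-halted c h with TM.δ printer (Config.state c) (readInput x (Config.ipos c)) (Config.work c (Config.wpos c)) | h
  ... | .nothing | refl = refl

  steps-halted : ∀ j c → halted printer x c → steps j c ≡ c
  steps-halted zero c h = refl
  steps-halted (suc j) c h = trans (cong (step printer x) (steps-halted j c h)) (step-halted c h)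

  Matches-halted : ∀ {c ip wp T o} → Matches c Halt ip wp T o → halted printer x c
  Matches-halted m0 rewrite Matches.state≡ m0 = refl

  computesInSpace : ∀ {y} → Phase (initConfig printer) (λ c → halted printer x c × Config.out c ≡ y) →
    ComputesInSpace printer x y B
  computesInSpace (mkPhase K (halts , out) bounded) =
    (K , subst (halted printer x) (sym (run≡steps K)) halts , trans (cong Config.out (run≡steps K)) out) ,
    λ t → subst (_≤ B) (sym (cong Config.wpos (run≡steps t))) (within t)
    where
    within : ∀ t → Config.wpos (steps t (initConfig printer)) ≤ B
    within t with t ≤? K
    ... | yes t≤K = bounded t t≤K
    ... | no t≰K = subst (λ c → Config.wpos c ≤ B) (sym stays) (bounded K ≤-refl)
      where
      stays : steps t (initConfig printer) ≡ steps K (initConfig printer)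
      stays = trans (cong (λ j → steps j (initConfig printer)) (sym (m∸n+n≡m (≰⇒≥ t≰K))))
                    (trans (steps-+ (t ∸ K) K _) (steps-halted (t ∸ K) _ halts))

readInput-replicate-< : ∀ m ip → ip < m → readInput (replicate m true) ip ≡ just true
readInput-replicate-< (suc m) zero _ = refl
readInput-replicate-< (suc m) (suc ip) (s≤s p) = readInput-replicate-< m ip p

readInput-replicate-end : ∀ m → readInput (replicate m true) m ≡ nothing
readInput-replicate-end zero = refl
readInput-replicate-end (suc m) = readInput-replicate-end m

encGates : Circuit → List Bool
encGates [] = []
encGates (g ∷ gs) = true ∷ encGate g ++ encGates gs

encPair : ℕ → List Bool
encPair p = encGates (input p ∷ andG (suc (2 * p) ∷ suc (2 * parent p) ∷ []) ∷ [])

++-assoc₇ : ∀ (o a E b Ex c E' d : List Bool) → ((((((o ++ a) ++ E) ++ b) ++ Ex) ++ c) ++ E') ++ d ≡ o ++ (a ++ (E ++ (b ++ (Ex ++ (c ++ (E' ++ d))))))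
++-assoc₇ o a E b Ex c E' d =
  trans (++-assoc (((((o ++ a) ++ E) ++ b) ++ Ex) ++ c) E' d)
  (trans (++-assoc ((((o ++ a) ++ E) ++ b) ++ Ex) c (E' ++ d))
  (trans (++-assoc (((o ++ a) ++ E) ++ b) Ex (c ++ (E' ++ d)))
  (trans (++-assoc ((o ++ a) ++ E) b (Ex ++ (c ++ (E' ++ d))))
  (trans (++-assoc (o ++ a) E (b ++ (Ex ++ (c ++ (E' ++ d)))))
  (++-assoc o a (E ++ (b ++ (Ex ++ (c ++ (E' ++ d))))))))))

encPair≡ : ∀ p → encPair p ≡ true ∷ false ∷ false ∷ ((encDigits (digitsℕ p) ++ false ∷ []) ++ (true ∷ true ∷ false ∷ true ∷ true ∷ false ∷ ((encDigits (digitsℕ p) ++ false ∷ []) ++ (true ∷ true ∷ false ∷ ((encDigits (dropDigit (digitsℕ p)) ++ false ∷ []) ++ false ∷ [])))))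
encPair≡ p rewrite encℕ-odd p | encℕ-odd (parent p) | ++-identityʳ (true ∷ true ∷ false ∷ true ∷ true ∷ false ∷ (encℕ p ++ true ∷ true ∷ false ∷ (encℕ (parent p) ++ false ∷ []))) | encℕ≡encDigits p | encℕ≡encDigits (parent p) | dropDigit-digitsℕ p = refl

encPairsFrom : ℕ → ℕ → List Bool
encPairsFrom p zero = []
encPairsFrom p (suc d) = encPair p ++ encPairsFrom (suc p) d

encOutputs : ℕ → List Bool
encOutputs zero = []
encOutputs (suc q) = true ∷ true ∷ true ∷ (encℕ q ++ encOutputs q)

encCircuit-++ : ∀ xs ys → encCircuit (xs ++ ys) ≡ encGates xs ++ encCircuit ys
encCircuit-++ [] ys = refl
encCircuit-++ (g ∷ xs) ys = cong (true ∷_) (trans (cong (encGate g ++_) (encCircuit-++ xs ys)) (sym (++-assoc (encGate g) (encGates xs) _)))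

encGates-++ : ∀ xs ys → encGates (xs ++ ys) ≡ encGates xs ++ encGates ys
encGates-++ [] ys = refl
encGates-++ (g ∷ xs) ys = cong (true ∷_) (trans (cong (encGate g ++_) (encGates-++ xs ys)) (sym (++-assoc (encGate g) (encGates xs) _)))

encList-pairOutputs : ∀ q → encList (pairOutputs q) ≡ encOutputs q ++ false ∷ []
encList-pairOutputs zero = refl
encList-pairOutputs (suc q) = cong (true ∷_) (trans (cong (_++ encList (pairOutputs q)) (encℕ-even q))
  (cong (λ z → true ∷ true ∷ z) (trans (cong (encℕ q ++_) (encList-pairOutputs q)) (sym (++-assoc (encℕ q) (encOutputs q) _)))))

encPairsFrom-++ : ∀ d p → encGates (pairGates p) ++ encPairsFrom p d ≡ encGates (pairGates (d + p))
encPairsFrom-++ zero p = ++-identityʳ _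
encPairsFrom-++ (suc d) p = trans (sym (++-assoc (encGates (pairGates p)) (encPair p) (encPairsFrom (suc p) d)))
  (trans (cong (_++ encPairsFrom (suc p) d) (sym (encGates-++ (pairGates p) _)))
    (trans (encPairsFrom-++ d (suc p)) (cong (λ z → encGates (pairGates z)) (+-suc d p))))

module NonemptyInput (k : ℕ) where
  m : ℕ
  m = suc k
  x : List Bool
  x = replicate m true
  B : ℕ
  B = 2 + 2 * ⌈log₂ m ⌉
  open Run x B

  length-x : length x ≡ m
  length-x = length-replicate m

  ≤length-x : ∀ {ip} → ip ≤ m → ip ≤ length x
  ≤length-x {ip} h = subst (ip ≤_) (sym length-x) h

  counter-fits : ∀ p → p ≤ m → suc (length (digitsℕ p)) ≤ B
  counter-fits p p≤m = ≤-trans (s≤s (length-digitsℕ≤ p m p≤m))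
    (s≤s (s≤s (m≤m+n ⌈log₂ m ⌉ _)))

  printPair : ∀ p → p < m → ∀ {c o} → Matches c Loop p 0 (digitTape (digitsℕ p)) o →
    Phase c (λ c' → Matches c' Loop (suc p) 0 (digitTape (digitsℕ (suc p))) (o ++ encPair p))
  printPair p p<m {o = o} m0 =
    stepPhase m0 z≤n (subst (λ i → program Loop i mark ≡ just (I1 , mark , stay , stay , just true)) (sym (readInput-replicate-< m p p<m)) refl) (λ _ → refl) (stay-within ipx) refl (λ i → refl) refl z≤n then λ m1 →
    printBit {o = o} {L = true ∷ []} ipx m1 refl then λ m2 →
    printBit {o = o} {L = true ∷ false ∷ []} ipx m2 refl then λ m3 →
    printCounter kA p ds ipx m3 bd then λ m4 →
    printBit {o = o1} {L = []} ipx (Matches-cong m4 refl refl (λ _ → refl) (sym (++-identityʳ _))) refl then λ m5 →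
    printBit {o = o1} {L = true ∷ []} ipx m5 refl then λ m6 →
    printBit {o = o1} {L = true ∷ true ∷ []} ipx m6 refl then λ m7 →
    printBit {o = o1} {L = true ∷ true ∷ false ∷ []} ipx m7 refl then λ m8 →
    printBit {o = o1} {L = true ∷ true ∷ false ∷ true ∷ []} ipx m8 refl then λ m9 →
    printBit {o = o1} {L = true ∷ true ∷ false ∷ true ∷ true ∷ []} ipx m9 refl then λ m10 →
    printCounter kB p ds ipx m10 bd then λ m11 →
    printBit {o = o2} {L = []} ipx (Matches-cong m11 refl refl (λ _ → refl) (sym (++-identityʳ _))) refl then λ m12 →
    printBit {o = o2} {L = true ∷ []} ipx m12 refl then λ m13 →
    printBit {o = o2} {L = true ∷ true ∷ []} ipx m13 refl then λ m14 →
    printParent kC p ds ipx m14 bd then λ m15 →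
    stepPhase m15 z≤n refl (λ _ → refl) (stay-within ipx) refl (λ i → refl) refl z≤n then λ m16 →
    stepPhase m16 z≤n refl (λ _ → refl) (stay-within ipx) refl (λ i → refl) refl (s≤s z≤n) then λ m17 →
    increment p ipx [] ds m17 bd then λ m18 →
    stepPhase m18 z≤n refl (λ _ → refl) adv refl (λ i → cong (λ z → digitTape z i) (incDigits-digitsℕ p)) outEq z≤n
    where
    ds = digitsℕ p
    o1 : List Bool
    o1 = (o ++ true ∷ false ∷ false ∷ []) ++ (encDigits ds ++ false ∷ [])
    o2 : List Bool
    o2 = (o1 ++ true ∷ true ∷ false ∷ true ∷ true ∷ false ∷ []) ++ (encDigits ds ++ false ∷ [])
    ipx : p ≤ length x
    ipx = ≤length-x (≤-trans (n≤1+n p) p<m)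
    bd : suc (length ds) ≤ B
    bd = counter-fits p (≤-trans (n≤1+n p) p<m)
    adv : suc p ⊓ length x ≡ suc p
    adv = m≤n⇒m⊓n≡m (≤length-x p<m)
    outEq : ((o2 ++ true ∷ true ∷ false ∷ []) ++ (encDigits (dropDigit ds) ++ false ∷ [])) ++ false ∷ [] ≡ o ++ encPair p
    outEq = trans (++-assoc₇ o _ _ _ _ _ _ _) (cong (o ++_) (sym (encPair≡ p)))

  printPairs : ∀ d p → p + d ≡ m → ∀ {c o} → Matches c Loop p 0 (digitTape (digitsℕ p)) o →
    Phase c (λ c' → Matches c' Loop m 0 (digitTape (digitsℕ m)) (o ++ encPairsFrom p d))
  printPairs zero p e {o = o} m0 = done (Matches-cong m0 e' refl (λ i → cong (λ z → digitTape (digitsℕ z) i) e') (sym (++-identityʳ o))) (subst (_≤ B) (sym (Matches.wpos≡ m0)) z≤n)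
    where
    e' : p ≡ m
    e' = trans (sym (+-identityʳ p)) e
  printPairs (suc d) p e {o = o} m0 =
    printPair p p<m m0 then λ m1 →
    mapPhase (printPairs d (suc p) (trans (sym (+-suc p d)) e) m1) (λ m2 → Matches-cong m2 refl refl (λ _ → refl) (++-assoc o (encPair p) (encPairsFrom (suc p) d)))
    where
    p<m : p < m
    p<m = subst (p <_) e (subst (_≤ p + suc d) (+-identityʳ (suc p)) (≤-trans (≤-reflexive (sym (+-suc p 0))) (+-monoʳ-≤ p (s≤s z≤n))))

  m≤length-x : m ≤ length x
  m≤length-x = ≤length-x ≤-refl

  printOutputs : ∀ q → q ≤ m → ∀ {c o} → Matches c FL m 0 (digitTape (digitsℕ q)) o →
    Phase c (λ c' → Matches c' Halt m 1 (digitTape []) (o ++ (encOutputs q ++ false ∷ false ∷ [])))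
  printOutputs zero q≤m {o = o} m0 =
    stepPhase m0 z≤n refl (λ _ → refl) (stay-within m≤length-x) refl (λ i → refl) refl (s≤s z≤n) then λ m1 →
    stepPhase m1 (s≤s z≤n) refl (λ ()) (stay-within m≤length-x) refl (writeTape-same (digitTape []) 0 refl) refl (s≤s z≤n) then λ m2 →
    stepPhase m2 (s≤s z≤n) refl (λ ()) (stay-within m≤length-x) refl (writeTape-same (digitTape []) 0 refl) (++-assoc o (false ∷ []) (false ∷ [])) (s≤s z≤n)
  printOutputs (suc q) q≤m {o = o} m0 =
    stepPhase m0 z≤n refl (λ _ → refl) (stay-within m≤length-x) refl (λ i → refl) refl (≤-trans (s≤s z≤n) bq) then λ m1 →
    decrement m m≤length-x (digitsℕ (suc q)) m1 (digitsℕ-suc≢[] q) bq then λ m2 →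
    printBit {o = o} {L = []} m≤length-x (Matches-cong m2 refl refl (λ i → cong (λ z → digitTape z i) (decDigits-digitsℕ q)) (sym (++-identityʳ o))) refl then λ m3 →
    printBit {o = o} {L = true ∷ []} m≤length-x m3 refl then λ m4 →
    printBit {o = o} {L = true ∷ true ∷ []} m≤length-x m4 refl then λ m5 →
    printCounter kFL m (digitsℕ q) m≤length-x m5 (counter-fits q (≤-trans (n≤1+n q) q≤m)) then λ m6 →
    mapPhase (printOutputs q (≤-trans (n≤1+n q) q≤m) m6) (λ m7 → Matches-cong m7 refl refl (λ _ → refl) out≡)
    where
    bq : suc (length (digitsℕ (suc q))) ≤ B
    bq = counter-fits (suc q) q≤m
    out≡ : ((o ++ true ∷ true ∷ true ∷ []) ++ (encDigits (digitsℕ q) ++ false ∷ [])) ++ (encOutputs q ++ false ∷ false ∷ []) ≡ o ++ (encOutputs (suc q) ++ false ∷ false ∷ [])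
    out≡ = trans (++-assoc (o ++ true ∷ true ∷ true ∷ []) _ _) (trans (++-assoc o _ _)
           (cong (λ z → o ++ (true ∷ true ∷ true ∷ z))
             (trans (cong (_++ (encOutputs q ++ false ∷ false ∷ [])) (sym (encℕ≡encDigits q))) (sym (++-assoc (encℕ q) (encOutputs q) _)))))

  outputAfterPairs : List Bool
  outputAfterPairs = (true ∷ true ∷ false ∷ false ∷ []) ++ encPairsFrom 0 m

  output : List Bool
  output = (outputAfterPairs ++ true ∷ true ∷ true ∷ []) ++ (encOutputs m ++ false ∷ false ∷ [])

  fullRun : Phase (initConfig printer) (λ c → Matches c Halt m 1 (digitTape []) output)
  fullRun =
    firstStep {λ c → Matches c F1 0 0 (digitTape []) (true ∷ [])} (mkMatches refl refl refl refl (λ _ → refl) refl) z≤n then λ m1 →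
    printBit {o = []} {L = true ∷ []} z≤n m1 refl then λ m2 →
    printBit {o = []} {L = true ∷ true ∷ []} z≤n m2 refl then λ m3 →
    printBit {o = []} {L = true ∷ true ∷ false ∷ []} z≤n m3 refl then λ m4 →
    printPairs m 0 refl m4 then λ m5 →
    stepPhase m5 z≤n (subst (λ i → program Loop i mark ≡ just (Fa , mark , stay , stay , just true)) (sym (readInput-replicate-end m)) refl) (λ _ → refl) (stay-within m≤length-x) refl (λ i → refl) refl z≤n then λ m6 →
    printBit {o = outputAfterPairs} {L = true ∷ []} m≤length-x m6 refl then λ m7 →
    printBit {o = outputAfterPairs} {L = true ∷ true ∷ []} m≤length-x m7 refl then λ m8 →
    printOutputs m ≤-refl m8

  encCircuit≡output : encCircuit (parentPairCircuit m) ≡ output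
  encCircuit≡output = begin
    encCircuit (parentPairCircuit m) ≡⟨ cong (λ z → true ∷ true ∷ false ∷ false ∷ z) (encCircuit-++ (pairGates m) _) ⟩
    true ∷ true ∷ false ∷ false ∷ (encGates (pairGates m) ++ (true ∷ true ∷ true ∷ (encList (pairOutputs m) ++ false ∷ [])))
      ≡⟨ cong₂ (λ a b → true ∷ true ∷ false ∷ false ∷ (a ++ (true ∷ true ∷ true ∷ (b ++ false ∷ []))))
           (trans (cong (λ z → encGates (pairGates z)) (sym (+-identityʳ m))) (sym (encPairsFrom-++ m 0))) (encList-pairOutputs m) ⟩
    true ∷ true ∷ false ∷ false ∷ (encPairsFrom 0 m ++ (true ∷ true ∷ true ∷ ((encOutputs m ++ false ∷ []) ++ false ∷ [])))
      ≡⟨ cong (λ z → true ∷ true ∷ false ∷ false ∷ (encPairsFrom 0 m ++ (true ∷ true ∷ true ∷ z))) (++-assoc (encOutputs m) _ _) ⟩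
    true ∷ true ∷ false ∷ false ∷ (encPairsFrom 0 m ++ (true ∷ true ∷ true ∷ (encOutputs m ++ false ∷ false ∷ [])))
      ≡⟨ sym (cong (λ z → true ∷ true ∷ false ∷ false ∷ z) (++-assoc (encPairsFrom 0 m) (true ∷ true ∷ true ∷ []) _)) ⟩
    output ∎
    where open ≡-Reasoning

  fullRun-computes : ComputesInSpace printer x (encCircuit (parentPairCircuit m)) B
  fullRun-computes = computesInSpace (mapPhase fullRun λ halts → Matches-halted halts , trans (Matches.out≡ halts) (sym encCircuit≡output))

module EmptyInput where
  open Run [] 0

  emptyRun-computes : ComputesInSpace printer [] (encCircuit (parentPairCircuit 0)) 0
  emptyRun-computes = computesInSpace (mapPhase emptyRun λ halts → Matches-halted halts , Matches.out≡ halts)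
    where
    emptyRun : Phase (initConfig printer) (λ c → Matches c Halt 0 0 (digitTape []) (encCircuit (parentPairCircuit 0)))
    emptyRun =
      firstStep {λ c → Matches c Z1 0 0 (digitTape []) (true ∷ [])} (mkMatches refl refl refl refl (λ _ → refl) refl) z≤n then λ m1 →
      printBit {o = []} {L = true ∷ []} z≤n m1 refl then λ m2 →
      printBit {o = []} {L = true ∷ true ∷ []} z≤n m2 refl then λ m3 →
      printBit {o = []} {L = true ∷ true ∷ false ∷ []} z≤n m3 refl then λ m4 →
      printBit {o = []} {L = true ∷ true ∷ false ∷ false ∷ []} z≤n m4 refl


printer-computes : ∀ m → ComputesInSpace printer (replicate m true) (encCircuit (parentPairCircuit m)) (2 * ⌈log₂ m ⌉ + 2)
printer-computes zero = ComputesInSpace-weaken z≤n EmptyInput.emptyRun-computes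
printer-computes (suc k) = ComputesInSpace-weaken (≤-reflexive (+-comm 2 _)) (NonemptyInput.fullRun-computes k)

ParentPair∈AC⁰ : AC⁰ ParentPair
ParentPair∈AC⁰ = parentPairCircuit , (printer , 2 , printer-computes) , WF-parentPairCircuit ,
  (2 , depth-parentPairCircuit) , (2 , size-parentPairCircuit) , λ _ → mk⇔ id id

theorem4p5 : Σ GraphClass λ 𝒞 → GAC⁰ 𝒞 × ¬ InSmallHereditaryClosure 𝒞
theorem4p5 = 𝒞 , (ParentPair , ParentPair∈AC⁰ , 1 , λ _ G∈𝒞 → G∈𝒞) ,
  λ (D , small , hereditary , 𝒞⊆D) → universal⇒¬Small D (hereditary-⊇𝒞⇒universal D hereditary 𝒞⊆D) small
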